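{- Let $p$ be a prime and $s\ge1$, $n,m\ge2$ integers, and let $0\le i\le m-1$ and $j\ge0$ be integers. Then \[ \tilde E_i(n\times m,p^s,p^j)=\varphi_n(p^s)(p^{s-1})^i(p^s)^{m-(i+1)}\Bigl(E((n-1)\times(m-1),p^{s-1},p^{j-(m-1)})+\sum_{k=i}^{\min(j,m-2)}\tilde E_k((n-1)\times(m-1),p^s,p^j)\Bigr), \] where $E((n-1)\times(m-1),p^{s-1},p^{j-(m-1)})=0$ when $j<m-1$, and the sum is empty when $i=m-1$. Also $\tilde E_i(n\times m,p^s,p^j)=0$ if $j<i$.
   Context: For $t\ge0$, $\mathbb{Z}_{p^t}$ is the ring of integers modulo $p^t$ ($\mathbb{Z}_1$ is the zero ring, whose unique matrix has exactly one solution). $E(a\times b,p^t,p^j)$ is the number of $a\times b$ matrices over $\mathbb{Z}_{p^t}$ such that $Ax\equiv0\pmod{p^t}$ has exactly $p^j$ solutions in $\mathbb{Z}_{p^t}^b$. A matrix over $\mathbb{Z}_{p^s}$ is relatively prime if some entry is not divisible by $p$; for $0\le k\le b-1$, $\tilde E_k(a\times b,p^s,p^j)$ is the number of relatively prime $a\times b$ matrices over $\mathbb{Z}_{p^s}$ with exactly $p^j$ solutions in which the first column containing an entry not divisible by $p$ is column $k+1$. For positive integers $u,c$, $\varphi_u(c)$ is the number of $u$-tuples $(a_1,\dots,a_u)$ with $1\le a_i\le c$ and at least one $a_i$ relatively prime to $c$. -}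

module Defs where

open import Data.Bool using (Bool; true; false; _∧_; not; if_then_else_)
open import Data.Nat using (ℕ; zero; suc; _+_; _*_; _∸_; _^_; _≡ᵇ_; _<ᵇ_; _≤ᵇ_)
open import Data.Nat.Divisibility using (_∣?_)
open import Data.Nat.GCD using (gcd)
open import Data.Fin using (Fin; toℕ)
open import Data.List using (List; []; _∷_; map; concatMap; allFin; upTo; length; filterᵇ)
open import Data.Bool.ListAction using (and)
open import Data.Nat.ListAction using (sum)
open import Data.Vec using (Vec; []; _∷_; lookup; zipWith; foldr)
open import Relation.Nullary.Decidable using (does)

vecsOf : ∀ {A : Set} → List A → (b : ℕ) → List (Vec A b)
vecsOf xs zero = [] ∷ []
vecsOf xs (suc b) = concatMap (λ x → map (x ∷_) (vecsOf xs b)) xs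

count : ∀ {A : Set} → (A → Bool) → List A → ℕ
count f xs = length (filterᵇ f xs)

-- a × b matrices over ℤ_q (entries are residues 0..q-1), stored as a rows
Mat : ℕ → ℕ → ℕ → Set
Mat q a b = Vec (Vec (Fin q) b) a

allMats : (q a b : ℕ) → List (Mat q a b)
allMats q a b = vecsOf (vecsOf (allFin q) b) a

dot : ∀ {q b} → Vec (Fin q) b → Vec (Fin q) b → ℕ
dot r x = Data.Vec.foldr _ _+_ 0 (zipWith (λ u v → toℕ u * toℕ v) r x)

isSol : ∀ {q a b} → Mat q a b → Vec (Fin q) b → Bool
isSol {q} A x = Data.Vec.foldr _ _∧_ true (Data.Vec.map (λ r → does (q ∣? dot r x)) A)

nSol : ∀ {q a b} → Mat q a b → ℕ
nSol {q} {a} {b} A = count (isSol A) (vecsOf (allFin q) b)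

E : (p a b t j : ℕ) → ℕ
E p a b t j = count (λ A → nSol A ≡ᵇ p ^ j) (allMats (p ^ t) a b)

colDiv : ∀ {q a b} → ℕ → Mat q a b → Fin b → Bool
colDiv p A c = Data.Vec.foldr _ _∧_ true (Data.Vec.map (λ r → does (p ∣? toℕ (lookup r c))) A)

-- the first column containing an entry not divisible by p is column k+1 (0-based index k)
firstCol : ∀ {q a b} → ℕ → Mat q a b → ℕ → Bool
firstCol {b = b} p A k =
  (k <ᵇ b) ∧ and (map (λ c → if toℕ c <ᵇ k then colDiv p A c
                              else (if toℕ c ≡ᵇ k then not (colDiv p A c) else true))
                      (allFin b))

Et : (p k a b s j : ℕ) → ℕ
Et p k a b s j = count (λ A → (nSol A ≡ᵇ p ^ j) ∧ firstCol p A k) (allMats (p ^ s) a b)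

φ : (u c : ℕ) → ℕ
φ u c = count (λ v → Data.Vec.foldr _ (λ x acc → (gcd x c ≡ᵇ 1) Data.Bool.∨ acc) false v)
              (vecsOf (map suc (upTo c)) u)

-- Σ_{k=lo}^{hi} f k  (empty if hi < lo)
sumRange : ℕ → ℕ → (ℕ → ℕ) → ℕ
sumRange lo hi f = sum (map (λ k → f (lo + k)) (upTo (suc hi ∸ lo)))

Eshift : (p a b t j d : ℕ) → ℕ
Eshift p a b t j d = if d ≤ᵇ j then E p a b t (j ∸ d) else 0

module Submission where

-- Let q = p^s and q' = p^(s-1).  A matrix counted by Ẽ_i has its first i columns divisible by p; its pivot
-- is the first row with a unit u in column i.  Scaling the pivot by u⁻¹ and clearing column i in the other
-- rows is a bijection onto a pivot row and an (n-1) × (m-1) matrix whose first i columns are divisible by p,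
-- and it preserves the number of solutions.  Rows above the pivot have column-i entry divisible by p (q'
-- choices), rows below are free (q choices), so summing over the position of the pivot gives
-- Σₖ q'^k (q - q') q^(n-1-k) = φ_n(q), while the pivot row contributes q'^i q^(m-1-i).  The reduced matrices
-- are sorted by their first column containing a unit, giving Σ_{k ≥ i} Ẽ_k, except those divisible by p
-- everywhere: these are p B with B over ℤ/p^(s-1), and have p^(m-1) times as many solutions as B.
-- The vanishing for j < i follows from the same recursion, by induction on the number of rows.

open import Defs
open import Data.Bool using (Bool; true; false; _∧_; _∨_; not; if_then_else_; T)
open import Data.Bool.ListAction using (and)
open import Data.Bool.Properties using (∧-assoc; ∧-comm; ∧-identityʳ; ∧-zeroʳ; not-involutive)
open import Data.Empty using (⊥-elim)
open import Data.Fin using (Fin; toℕ; fromℕ<; cast; combine; remQuot) renaming (zero to fzero; suc to fsuc)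
import Data.Fin.Properties as Fin
open import Data.List using (List; []; _∷_; map; concatMap; allFin; upTo; applyUpTo; length; _++_)
import Data.List.Properties as List
open import Data.Nat
open import Data.Nat.Coprimality using (Coprime; coprime-divisor; coprime-Bézout; coprime⇒gcd≡1)
open import Data.Nat.DivMod
open import Data.Nat.Divisibility
open import Data.Nat.GCD using (gcd; gcd-greatest; module Bézout)
open import Data.Nat.ListAction using (sum)
open import Data.Nat.Primality using (Prime; prime⇒nonZero; prime⇒irreducible; prime⇒nonTrivial)
open import Data.Nat.Properties
open import Data.Nat.Tactic.RingSolver using (solve-∀)
open import Data.Product using (_×_; _,_; proj₁; proj₂; Σ)
open import Data.Sum using (inj₁; inj₂)
open import Data.Unit using (tt)
import Data.Unit.Properties as Unit
open import Data.Vec using (Vec; []; _∷_; zipWith; insertAt; lookup; replicate; tail) renaming (map to vmap; _++_ to _++ᵥ_)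
import Data.Vec.Properties as Vec
open import Relation.Binary.Definitions using (DecidableEquality)
open import Relation.Binary.PropositionalEquality
open import Relation.Nullary using (Dec; yes; no; does; ¬_)
open import Relation.Nullary.Decidable using (dec-true; dec-false; does-⇔)
open import Function.Bundles using (mk⇔)

-- Finite sums over lists

𝟙 : Bool → ℕ
𝟙 true = 1
𝟙 false = 0

𝟙-∧ : ∀ a b → 𝟙 (a ∧ b) ≡ 𝟙 a * 𝟙 b
𝟙-∧ true b = sym (+-identityʳ (𝟙 b))
𝟙-∧ false b = refl

𝟙≤1 : ∀ b → 𝟙 b ≤ 1
𝟙≤1 true = ≤-refl
𝟙≤1 false = z≤n

∑ : {A : Set} → List A → (A → ℕ) → ℕ
∑ L F = sum (map F L)

module _ {A : Set} where

  ∑-cong : ∀ (L : List A) {F G : A → ℕ} → (∀ x → F x ≡ G x) → ∑ L F ≡ ∑ L G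
  ∑-cong [] e = refl
  ∑-cong (x ∷ L) e = cong₂ _+_ (e x) (∑-cong L e)

  ∑-mono : ∀ (L : List A) {F G : A → ℕ} → (∀ x → F x ≤ G x) → ∑ L F ≤ ∑ L G
  ∑-mono [] h = ≤-refl
  ∑-mono (x ∷ L) h = +-mono-≤ (h x) (∑-mono L h)

  ∑-++ : ∀ (L M : List A) (F : A → ℕ) → ∑ (L ++ M) F ≡ ∑ L F + ∑ M F
  ∑-++ [] M F = refl
  ∑-++ (x ∷ L) M F = trans (cong (F x +_) (∑-++ L M F)) (sym (+-assoc (F x) _ _))

  ∑-zero : ∀ (L : List A) → ∑ L (λ _ → 0) ≡ 0
  ∑-zero [] = refl
  ∑-zero (x ∷ L) = ∑-zero L

  ∑-const : ∀ (L : List A) c → ∑ L (λ _ → c) ≡ length L * c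
  ∑-const [] c = refl
  ∑-const (x ∷ L) c = cong (c +_) (∑-const L c)

  ∑-+ : ∀ (L : List A) (F G : A → ℕ) → ∑ L (λ x → F x + G x) ≡ ∑ L F + ∑ L G
  ∑-+ [] F G = refl
  ∑-+ (x ∷ L) F G = trans (cong (F x + G x +_) (∑-+ L F G)) (lemma (F x) (G x) (∑ L F) (∑ L G))
    where lemma : ∀ a b c d → a + b + (c + d) ≡ a + c + (b + d)
          lemma = solve-∀

  ∑-*ˡ : ∀ (L : List A) c (F : A → ℕ) → ∑ L (λ x → c * F x) ≡ c * ∑ L F
  ∑-*ˡ [] c F = sym (*-zeroʳ c)
  ∑-*ˡ (x ∷ L) c F = trans (cong (c * F x +_) (∑-*ˡ L c F)) (sym (*-distribˡ-+ c (F x) _))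

  ∑-*ʳ : ∀ (L : List A) c (F : A → ℕ) → ∑ L (λ x → F x * c) ≡ ∑ L F * c
  ∑-*ʳ L c F = trans (∑-cong L (λ x → *-comm (F x) c)) (trans (∑-*ˡ L c F) (*-comm c _))

  count≡∑𝟙 : ∀ (f : A → Bool) L → count f L ≡ ∑ L (λ x → 𝟙 (f x))
  count≡∑𝟙 f [] = refl
  count≡∑𝟙 f (x ∷ L) with f x
  ... | true = cong suc (count≡∑𝟙 f L)
  ... | false = count≡∑𝟙 f L

module _ {A B : Set} where

  ∑-map : ∀ (g : A → B) L (F : B → ℕ) → ∑ (map g L) F ≡ ∑ L (λ x → F (g x))
  ∑-map g [] F = refl
  ∑-map g (x ∷ L) F = cong (F (g x) +_) (∑-map g L F)

  ∑-concatMap : ∀ (f : A → List B) L (F : B → ℕ) → ∑ (concatMap f L) F ≡ ∑ L (λ x → ∑ (f x) F)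
  ∑-concatMap f [] F = refl
  ∑-concatMap f (x ∷ L) F = trans (∑-++ (f x) (concatMap f L) F) (cong (∑ (f x) F +_) (∑-concatMap f L F))

  ∑-comm : ∀ (L : List A) (M : List B) (F : A → B → ℕ) → ∑ L (λ a → ∑ M (λ b → F a b)) ≡ ∑ M (λ b → ∑ L (λ a → F a b))
  ∑-comm [] M F = sym (∑-zero M)
  ∑-comm (x ∷ L) M F = trans (cong (∑ M (F x) +_) (∑-comm L M F)) (sym (∑-+ M (F x) _))

module _ {A : Set} (_≟_ : DecidableEquality A) where

  record Enumeration (L : List A) : Set where
    constructor enumeration
    field occurs-once : ∀ y → ∑ L (λ x → 𝟙 (does (x ≟ y))) ≡ 1

  open Enumeration public

  private
    ∑-𝟙≡-* : ∀ (L : List A) y (G : A → ℕ) → ∑ L (λ x → 𝟙 (does (x ≟ y)) * G x) ≡ ∑ L (λ x → 𝟙 (does (x ≟ y))) * G y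
    ∑-𝟙≡-* [] y G = refl
    ∑-𝟙≡-* (x ∷ L) y G with x ≟ y
    ... | yes refl = cong₂ _+_ (+-identityʳ (G x)) (∑-𝟙≡-* L x G)
    ... | no _ = ∑-𝟙≡-* L y G

  ∑-select : ∀ L → Enumeration L → ∀ y (G : A → ℕ) → ∑ L (λ x → 𝟙 (does (x ≟ y)) * G x) ≡ G y
  ∑-select L e y G = trans (∑-𝟙≡-* L y G) (trans (cong (_* G y) (occurs-once e y)) (+-identityʳ (G y)))

  term≤∑ : ∀ L → Enumeration L → ∀ y (G : A → ℕ) → G y ≤ ∑ L G
  term≤∑ L e y G = subst (_≤ ∑ L G) (∑-select L e y G) (∑-mono L bound)
    where
    bound : ∀ x → 𝟙 (does (x ≟ y)) * G x ≤ G x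
    bound x = ≤-trans (*-monoˡ-≤ (G x) (𝟙≤1 (does (x ≟ y)))) (≤-reflexive (+-identityʳ (G x)))

module _ {A C B : Set} {_≟A_ : DecidableEquality A} {_≟C_ : DecidableEquality C} {_≟B_ : DecidableEquality B}
         (LA : List A) (LC : List C) (LB : List B)
         (eA : Enumeration _≟A_ LA) (eC : Enumeration _≟C_ LC) (eB : Enumeration _≟B_ LB)
         (g : A → C → B) (h₁ : B → A) (h₂ : B → C)
         (h₁g : ∀ a c → h₁ (g a c) ≡ a) (h₂g : ∀ a c → h₂ (g a c) ≡ c) (gh : ∀ b → g (h₁ b) (h₂ b) ≡ b) where

  private
    𝟙-graph : ∀ b a c → 𝟙 (does (b ≟B g a c)) ≡ 𝟙 (does (a ≟A h₁ b)) * 𝟙 (does (c ≟C h₂ b))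
    𝟙-graph b a c with b ≟B g a c | a ≟A h₁ b | c ≟C h₂ b
    ... | yes _ | yes _ | yes _ = refl
    ... | yes e | no ne | _ = ⊥-elim (ne (trans (sym (h₁g a c)) (cong h₁ (sym e))))
    ... | yes e | yes _ | no ne = ⊥-elim (ne (trans (sym (h₂g a c)) (cong h₂ (sym e))))
    ... | no ne | yes e₁ | yes e₂ = ⊥-elim (ne (trans (sym (gh b)) (cong₂ g (sym e₁) (sym e₂))))
    ... | no _ | no _ | _ = refl
    ... | no _ | yes _ | no _ = refl

    fibre-size : ∀ b → ∑ LA (λ a → ∑ LC (λ c → 𝟙 (does (b ≟B g a c)))) ≡ 1
    fibre-size b = begin
        ∑ LA (λ a → ∑ LC (λ c → 𝟙 (does (b ≟B g a c))))
      ≡⟨ ∑-cong LA (λ a → trans (∑-cong LC (𝟙-graph b a)) (∑-*ˡ LC (𝟙 (does (a ≟A h₁ b))) _)) ⟩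
        ∑ LA (λ a → 𝟙 (does (a ≟A h₁ b)) * ∑ LC (λ c → 𝟙 (does (c ≟C h₂ b))))
      ≡⟨ ∑-select _≟A_ LA eA (h₁ b) (λ _ → ∑ LC (λ c → 𝟙 (does (c ≟C h₂ b)))) ⟩
        ∑ LC (λ c → 𝟙 (does (c ≟C h₂ b)))
      ≡⟨ occurs-once eC (h₂ b) ⟩
        1 ∎
      where open ≡-Reasoning

  ∑-reindex₂ : ∀ (F : B → ℕ) → ∑ LA (λ a → ∑ LC (λ c → F (g a c))) ≡ ∑ LB F
  ∑-reindex₂ F = begin
      ∑ LA (λ a → ∑ LC (λ c → F (g a c)))
    ≡⟨ ∑-cong LA (λ a → ∑-cong LC (λ c → sym (∑-select _≟B_ LB eB (g a c) F))) ⟩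
      ∑ LA (λ a → ∑ LC (λ c → ∑ LB (λ b → 𝟙 (does (b ≟B g a c)) * F b)))
    ≡⟨ trans (∑-cong LA (λ a → ∑-comm LC LB _)) (∑-comm LA LB _) ⟩
      ∑ LB (λ b → ∑ LA (λ a → ∑ LC (λ c → 𝟙 (does (b ≟B g a c)) * F b)))
    ≡⟨ ∑-cong LB (λ b → trans (∑-cong LA (λ a → ∑-*ʳ LC (F b) _)) (∑-*ʳ LA (F b) _)) ⟩
      ∑ LB (λ b → ∑ LA (λ a → ∑ LC (λ c → 𝟙 (does (b ≟B g a c)))) * F b)
    ≡⟨ ∑-cong LB (λ b → trans (cong (_* F b) (fibre-size b)) (*-identityˡ (F b))) ⟩
      ∑ LB F ∎
    where open ≡-Reasoning

∑-reindex : ∀ {A B : Set} {_≟A_ : DecidableEquality A} {_≟B_ : DecidableEquality B} (LA : List A) (LB : List B) →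
  Enumeration _≟A_ LA → Enumeration _≟B_ LB → (g : A → B) (h : B → A) →
  (∀ a → h (g a) ≡ a) → (∀ b → g (h b) ≡ b) → ∀ (F : B → ℕ) → ∑ LA (λ a → F (g a)) ≡ ∑ LB F
∑-reindex LA LB eA eB g h hg gh F =
  trans (∑-cong LA (λ a → sym (+-identityʳ (F (g a)))))
        (∑-reindex₂ LA (tt ∷ []) LB eA tt-enumeration eB (λ a _ → g a) h (λ _ → tt) (λ a _ → hg a) (λ _ _ → refl) gh F)
  where
  tt-enumeration : Enumeration Unit._≟_ (tt ∷ [])
  tt-enumeration = enumeration (λ { tt → refl })

∑-allFin-suc : ∀ n (F : Fin (suc n) → ℕ) → ∑ (allFin (suc n)) F ≡ F fzero + ∑ (allFin n) (λ x → F (fsuc x))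
∑-allFin-suc n F = cong (F fzero +_) (trans (cong (λ L → ∑ L F) (sym (List.map-tabulate (λ x → x) fsuc))) (∑-map fsuc (allFin n) F))

allFin-enumeration : ∀ n → Enumeration Fin._≟_ (allFin n)
allFin-enumeration n = enumeration (once n)
  where
  once : ∀ n (y : Fin n) → ∑ (allFin n) (λ x → 𝟙 (does (x Fin.≟ y))) ≡ 1
  once (suc n) fzero = trans (∑-allFin-suc n (λ x → 𝟙 (does (x Fin.≟ fzero)))) (cong suc (∑-zero (allFin n)))
  once (suc n) (fsuc y) = trans (∑-allFin-suc n (λ x → 𝟙 (does (x Fin.≟ fsuc y)))) (once n y)

∑-allFin-1 : ∀ n → ∑ (allFin n) (λ _ → 1) ≡ n
∑-allFin-1 n = trans (∑-const (allFin n) 1) (trans (*-identityʳ _) (List.length-tabulate (λ x → x)))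

∑-allFin-combine : ∀ m n (F : Fin (m * n) → ℕ) →
  ∑ (allFin (m * n)) F ≡ ∑ (allFin m) (λ a → ∑ (allFin n) (λ r → F (combine a r)))
∑-allFin-combine m n F = sym (∑-reindex₂ (allFin m) (allFin n) (allFin (m * n)) (allFin-enumeration m) (allFin-enumeration n) (allFin-enumeration (m * n))
  combine (λ x → proj₁ (remQuot {m} n x)) (λ x → proj₂ (remQuot {m} n x))
  (λ a r → cong proj₁ (Fin.remQuot-combine a r)) (λ a r → cong proj₂ (Fin.remQuot-combine a r))
  (Fin.combine-remQuot {m} n) F)

∑-allFin-cast : ∀ {m n} (e : m ≡ n) (F : Fin n → ℕ) → ∑ (allFin n) F ≡ ∑ (allFin m) (λ x → F (cast e x))
∑-allFin-cast {m} refl F = ∑-cong (allFin m) (λ x → cong F (sym (Fin.cast-is-id refl x)))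

module _ {A : Set} where

  ∑-vecsOf-suc : ∀ (L : List A) b (F : Vec A (suc b) → ℕ) →
    ∑ (vecsOf L (suc b)) F ≡ ∑ L (λ x → ∑ (vecsOf L b) (λ v → F (x ∷ v)))
  ∑-vecsOf-suc L b F = trans (∑-concatMap (λ x → map (x ∷_) (vecsOf L b)) L F) (∑-cong L (λ x → ∑-map (x ∷_) (vecsOf L b) F))

  ∑-vecsOf-++ : ∀ (L : List A) k n (F : Vec A (k + n) → ℕ) →
    ∑ (vecsOf L k) (λ P → ∑ (vecsOf L n) (λ S → F (P ++ᵥ S))) ≡ ∑ (vecsOf L (k + n)) F
  ∑-vecsOf-++ L zero n F = +-identityʳ _
  ∑-vecsOf-++ L (suc k) n F = begin
      ∑ (vecsOf L (suc k)) (λ P → ∑ (vecsOf L n) (λ S → F (P ++ᵥ S)))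
    ≡⟨ ∑-vecsOf-suc L k _ ⟩
      ∑ L (λ x → ∑ (vecsOf L k) (λ P → ∑ (vecsOf L n) (λ S → F (x ∷ P ++ᵥ S))))
    ≡⟨ ∑-cong L (λ x → ∑-vecsOf-++ L k n (λ B → F (x ∷ B))) ⟩
      ∑ L (λ x → ∑ (vecsOf L (k + n)) (λ B → F (x ∷ B)))
    ≡⟨ sym (∑-vecsOf-suc L (k + n) F) ⟩
      ∑ (vecsOf L (suc k + n)) F ∎
    where open ≡-Reasoning

  ∑-vecsOf-const : ∀ (L : List A) b c → ∑ (vecsOf L b) (λ _ → c) ≡ length L ^ b * c
  ∑-vecsOf-const L zero c = trans (+-identityʳ c) (sym (+-identityʳ c))
  ∑-vecsOf-const L (suc b) c = begin
      ∑ (vecsOf L (suc b)) (λ _ → c)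
    ≡⟨ ∑-vecsOf-suc L b _ ⟩
      ∑ L (λ _ → ∑ (vecsOf L b) (λ _ → c))
    ≡⟨ trans (∑-cong L (λ _ → ∑-vecsOf-const L b c)) (∑-const L _) ⟩
      length L * (length L ^ b * c)
    ≡⟨ sym (*-assoc (length L) _ c) ⟩
      length L ^ suc b * c ∎
    where open ≡-Reasoning

  ∑-vecsOf-insertAt : ∀ (L : List A) b (ι : Fin (suc b)) (G : Vec A (suc b) → ℕ) →
    ∑ (vecsOf L (suc b)) G ≡ ∑ L (λ c → ∑ (vecsOf L b) (λ y → G (insertAt y ι c)))
  ∑-vecsOf-insertAt L b fzero G = ∑-vecsOf-suc L b G
  ∑-vecsOf-insertAt L (suc b) (fsuc ι) G = begin
      ∑ (vecsOf L (suc (suc b))) G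
    ≡⟨ ∑-vecsOf-suc L (suc b) G ⟩
      ∑ L (λ x → ∑ (vecsOf L (suc b)) (λ v → G (x ∷ v)))
    ≡⟨ ∑-cong L (λ x → ∑-vecsOf-insertAt L b ι (λ v → G (x ∷ v))) ⟩
      ∑ L (λ x → ∑ L (λ c → ∑ (vecsOf L b) (λ y → G (x ∷ insertAt y ι c))))
    ≡⟨ ∑-comm L L _ ⟩
      ∑ L (λ c → ∑ L (λ x → ∑ (vecsOf L b) (λ y → G (x ∷ insertAt y ι c))))
    ≡⟨ ∑-cong L (λ c → sym (∑-vecsOf-suc L b (λ y → G (insertAt y (fsuc ι) c)))) ⟩
      ∑ L (λ c → ∑ (vecsOf L (suc b)) (λ y → G (insertAt y (fsuc ι) c))) ∎
    where open ≡-Reasoning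

  term≤∑-vecsOf : ∀ {_≟_ : DecidableEquality A} L → Enumeration _≟_ L → ∀ b (y : Vec A b) (G : Vec A b → ℕ) → G y ≤ ∑ (vecsOf L b) G
  term≤∑-vecsOf L e zero [] G = m≤m+n (G []) 0
  term≤∑-vecsOf L e (suc b) (y ∷ ys) G = begin
      G (y ∷ ys)
    ≤⟨ term≤∑-vecsOf L e b ys (λ v → G (y ∷ v)) ⟩
      ∑ (vecsOf L b) (λ v → G (y ∷ v))
    ≤⟨ term≤∑ _ L e y (λ x → ∑ (vecsOf L b) (λ v → G (x ∷ v))) ⟩
      ∑ L (λ x → ∑ (vecsOf L b) (λ v → G (x ∷ v)))
    ≡⟨ sym (∑-vecsOf-suc L b G) ⟩
      ∑ (vecsOf L (suc b)) G ∎
    where open ≤-Reasoning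

∑-vecsOf-zipWith : ∀ {A B C : Set} (L : List A) (L₁ : List B) (L₂ : List C) (g : B → C → A) →
  (∀ (H : A → ℕ) → ∑ L H ≡ ∑ L₁ (λ t → ∑ L₂ (λ σ → H (g t σ)))) →
  ∀ k (F : Vec A k → ℕ) → ∑ (vecsOf L k) F ≡ ∑ (vecsOf L₁ k) (λ T → ∑ (vecsOf L₂ k) (λ S → F (zipWith g T S)))
∑-vecsOf-zipWith L L₁ L₂ g hyp zero F = trans (+-identityʳ (F [])) (sym (trans (+-identityʳ _) (+-identityʳ _)))
∑-vecsOf-zipWith L L₁ L₂ g hyp (suc k) F = begin
    ∑ (vecsOf L (suc k)) F
  ≡⟨ ∑-vecsOf-suc L k F ⟩
    ∑ L (λ x → ∑ (vecsOf L k) (λ v → F (x ∷ v)))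
  ≡⟨ ∑-cong L (λ x → ∑-vecsOf-zipWith L L₁ L₂ g hyp k (λ v → F (x ∷ v))) ⟩
    ∑ L (λ x → ∑ (vecsOf L₁ k) (λ T → ∑ (vecsOf L₂ k) (λ S → F (x ∷ zipWith g T S))))
  ≡⟨ hyp _ ⟩
    ∑ L₁ (λ t → ∑ L₂ (λ σ → ∑ (vecsOf L₁ k) (λ T → ∑ (vecsOf L₂ k) (λ S → F (g t σ ∷ zipWith g T S)))))
  ≡⟨ ∑-cong L₁ (λ t → ∑-comm L₂ (vecsOf L₁ k) (λ σ T → ∑ (vecsOf L₂ k) (λ S → F (g t σ ∷ zipWith g T S)))) ⟩
    ∑ L₁ (λ t → ∑ (vecsOf L₁ k) (λ T → ∑ L₂ (λ σ → ∑ (vecsOf L₂ k) (λ S → F (g t σ ∷ zipWith g T S)))))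
  ≡⟨ ∑-cong L₁ (λ t → ∑-cong (vecsOf L₁ k) (λ T → sym (∑-vecsOf-suc L₂ k (λ S → F (zipWith g (t ∷ T) S))))) ⟩
    ∑ L₁ (λ t → ∑ (vecsOf L₁ k) (λ T → ∑ (vecsOf L₂ (suc k)) (λ S → F (zipWith g (t ∷ T) S))))
  ≡⟨ sym (∑-vecsOf-suc L₁ k _) ⟩
    ∑ (vecsOf L₁ (suc k)) (λ T → ∑ (vecsOf L₂ (suc k)) (λ S → F (zipWith g T S))) ∎
  where open ≡-Reasoning

∑-applyUpTo : ∀ n (g f : ℕ → ℕ) → ∑ (applyUpTo g n) f ≡ ∑ (upTo n) (λ x → f (g x))
∑-applyUpTo zero g f = refl
∑-applyUpTo (suc n) g f = cong (f (g 0) +_) (trans (∑-applyUpTo n (λ x → g (suc x)) f) (sym (∑-applyUpTo n suc (λ x → f (g x)))))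

∑-upTo-suc : ∀ n (f : ℕ → ℕ) → ∑ (upTo (suc n)) f ≡ f 0 + ∑ (upTo n) (λ x → f (suc x))
∑-upTo-suc n f = cong (f 0 +_) (∑-applyUpTo n suc f)

∑-upTo-+ : ∀ a c (f : ℕ → ℕ) → ∑ (upTo (a + c)) f ≡ ∑ (upTo a) f + ∑ (upTo c) (λ t → f (a + t))
∑-upTo-+ zero c f = refl
∑-upTo-+ (suc a) c f = begin
    ∑ (upTo (suc a + c)) f
  ≡⟨ ∑-upTo-suc (a + c) f ⟩
    f 0 + ∑ (upTo (a + c)) (λ x → f (suc x))
  ≡⟨ cong (f 0 +_) (∑-upTo-+ a c (λ x → f (suc x))) ⟩
    f 0 + (∑ (upTo a) (λ x → f (suc x)) + ∑ (upTo c) (λ t → f (suc a + t)))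
  ≡⟨ sym (+-assoc (f 0) _ _) ⟩
    f 0 + ∑ (upTo a) (λ x → f (suc x)) + ∑ (upTo c) (λ t → f (suc a + t))
  ≡⟨ cong (_+ ∑ (upTo c) (λ t → f (suc a + t))) (sym (∑-upTo-suc a f)) ⟩
    ∑ (upTo (suc a)) f + ∑ (upTo c) (λ t → f (suc a + t)) ∎
  where open ≡-Reasoning

∑-upTo-rotate : ∀ n (f : ℕ → ℕ) → f n ≡ f 0 → ∑ (upTo n) (λ x → f (suc x)) ≡ ∑ (upTo n) f
∑-upTo-rotate zero f h = refl
∑-upTo-rotate (suc n) f h = begin
    ∑ (upTo (suc n)) (λ x → f (suc x))
  ≡⟨ cong (λ m → ∑ (upTo m) (λ x → f (suc x))) (+-comm 1 n) ⟩
    ∑ (upTo (n + 1)) (λ x → f (suc x))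
  ≡⟨ ∑-upTo-+ n 1 (λ x → f (suc x)) ⟩
    ∑ (upTo n) (λ x → f (suc x)) + (f (suc (n + 0)) + 0)
  ≡⟨ cong (λ z → ∑ (upTo n) (λ x → f (suc x)) + (f (suc z) + 0)) (+-identityʳ n) ⟩
    ∑ (upTo n) (λ x → f (suc x)) + (f (suc n) + 0)
  ≡⟨ cong (λ z → ∑ (upTo n) (λ x → f (suc x)) + z) (trans (+-identityʳ _) h) ⟩
    ∑ (upTo n) (λ x → f (suc x)) + f 0
  ≡⟨ trans (+-comm _ (f 0)) (sym (∑-upTo-suc n f)) ⟩
    ∑ (upTo (suc n)) f ∎
  where open ≡-Reasoning

∑-allFin-toℕ : ∀ n (f : ℕ → ℕ) → ∑ (allFin n) (λ e → f (toℕ e)) ≡ ∑ (upTo n) f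
∑-allFin-toℕ zero f = refl
∑-allFin-toℕ (suc n) f = trans (∑-allFin-suc n (λ e → f (toℕ e))) (trans (cong (f 0 +_) (∑-allFin-toℕ n (λ x → f (suc x)))) (sym (∑-upTo-suc n f)))

-- Arithmetic modulo q

from-does-true : ∀ {P : Set} (d : Dec P) → does d ≡ true → P
from-does-true (yes p) _ = p

from-does-false : ∀ {P : Set} (d : Dec P) → does d ≡ false → ¬ P
from-does-false (no ¬p) _ = ¬p

dot-insertAt : ∀ {q b} (σ y : Vec (Fin q) b) (ι : Fin (suc b)) a c →
  dot (insertAt σ ι a) (insertAt y ι c) ≡ toℕ a * toℕ c + dot σ y
dot-insertAt σ y fzero a c = refl
dot-insertAt (s ∷ σ) (z ∷ y) (fsuc ι) a c =
  trans (cong (toℕ s * toℕ z +_) (dot-insertAt σ y ι a c)) (lemma (toℕ s * toℕ z) (toℕ a * toℕ c) (dot σ y))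
  where lemma : ∀ x y z → x + (y + z) ≡ y + (x + z)
        lemma = solve-∀

1≤nSol : ∀ {m a b} .{{_ : NonZero m}} (B : Vec (Vec (Fin m) b) a) → 1 ≤ nSol B
1≤nSol {m} {b = b} B = begin
    1
  ≡⟨ cong 𝟙 (sym (zero-solves B)) ⟩
    𝟙 (isSol B 0ᵥ)
  ≤⟨ term≤∑-vecsOf (allFin m) (allFin-enumeration m) b 0ᵥ (λ y → 𝟙 (isSol B y)) ⟩
    ∑ (vecsOf (allFin m) b) (λ y → 𝟙 (isSol B y))
  ≡⟨ sym (count≡∑𝟙 (isSol B) (vecsOf (allFin m) b)) ⟩
    nSol B ∎
  where
  open ≤-Reasoning
  0ᵥ : Vec (Fin m) b
  0ᵥ = replicate b (fromℕ< (>-nonZero⁻¹ m))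
  dot-0ᵥ : ∀ {b} (r : Vec (Fin m) b) → dot r (replicate b (fromℕ< (>-nonZero⁻¹ m))) ≡ 0
  dot-0ᵥ [] = refl
  dot-0ᵥ (u ∷ r) = cong₂ _+_ (trans (cong (toℕ u *_) (Fin.toℕ-fromℕ< (>-nonZero⁻¹ m))) (*-zeroʳ (toℕ u))) (dot-0ᵥ r)
  zero-solves : ∀ {a} (B : Vec (Vec (Fin m) b) a) → isSol B 0ᵥ ≡ true
  zero-solves [] = refl
  zero-solves (r ∷ B) = cong₂ _∧_ (trans (cong (λ z → does (m ∣? z)) (dot-0ᵥ r)) (dec-true (m ∣? 0) (m ∣0))) (zero-solves B)

module Residues (q : ℕ) .{{q≢0 : NonZero q}} where

  residue : ℕ → Fin q
  residue n = fromℕ< (m%n<n n q)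

  toℕ-residue : ∀ n → toℕ (residue n) ≡ n % q
  toℕ-residue n = Fin.toℕ-fromℕ< (m%n<n n q)

  _≋_ : ℕ → ℕ → Set
  a ≋ b = a % q ≡ b % q

  ≋-refl : ∀ {a} → a ≋ a
  ≋-refl = refl

  ≋-+ : ∀ {a a' b b'} → a ≋ a' → b ≋ b' → (a + b) ≋ (a' + b')
  ≋-+ {a} {a'} {b} {b'} e f = trans (%-distribˡ-+ a b q) (trans (cong₂ (λ x y → (x + y) % q) e f) (sym (%-distribˡ-+ a' b' q)))

  ≋-* : ∀ {a a' b b'} → a ≋ a' → b ≋ b' → (a * b) ≋ (a' * b')
  ≋-* {a} {a'} {b} {b'} e f = trans (%-distribˡ-* a b q) (trans (cong₂ (λ x y → (x * y) % q) e f) (sym (%-distribˡ-* a' b' q)))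

  residue-≋ : ∀ n → toℕ (residue n) ≋ n
  residue-≋ n = trans (cong (_% q) (toℕ-residue n)) (m%n%n≡m%n n q)

  ≋⇒toℕ-injective : ∀ (x y : Fin q) → toℕ x ≋ toℕ y → x ≡ y
  ≋⇒toℕ-injective x y e = Fin.toℕ-injective (trans (sym (m<n⇒m%n≡m (Fin.toℕ<n x))) (trans e (m<n⇒m%n≡m (Fin.toℕ<n y))))

  ∣⇒≋0 : ∀ {n} → q ∣ n → n ≋ 0
  ∣⇒≋0 {n} d = trans (n∣m⇒m%n≡0 n q d) (sym (m<n⇒m%n≡m (>-nonZero⁻¹ q)))

  ∣-resp-≋ : ∀ {a b} → a ≋ b → q ∣ a → q ∣ b
  ∣-resp-≋ {a} {b} e d = m%n≡0⇒n∣m b q (trans (sym e) (n∣m⇒m%n≡0 a q d))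

  does-∣-resp-≋ : ∀ {a b} → a ≋ b → does (q ∣? a) ≡ does (q ∣? b)
  does-∣-resp-≋ e = does-⇔ (mk⇔ (∣-resp-≋ e) (∣-resp-≋ (sym e))) (q ∣? _) (q ∣? _)

  _⊕_ : Fin q → Fin q → Fin q
  a ⊕ b = residue (toℕ a + toℕ b)

  _⊗_ : Fin q → Fin q → Fin q
  a ⊗ b = residue (toℕ a * toℕ b)

  _⊕ᵥ_ : ∀ {b} → Vec (Fin q) b → Vec (Fin q) b → Vec (Fin q) b
  σ ⊕ᵥ τ = zipWith _⊕_ σ τ

  _⊗ᵥ_ : ∀ {b} → Fin q → Vec (Fin q) b → Vec (Fin q) b
  t ⊗ᵥ ρ = vmap (t ⊗_) ρ

  dot-⊕⊗ : ∀ {b} (σ ρ y : Vec (Fin q) b) t → dot (σ ⊕ᵥ (t ⊗ᵥ ρ)) y ≋ (dot σ y + toℕ t * dot ρ y)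
  dot-⊕⊗ [] [] [] t = cong (_% q) (sym (*-zeroʳ (toℕ t)))
  dot-⊕⊗ (a ∷ σ) (r ∷ ρ) (c ∷ y) t =
    trans (≋-+ (≋-* (trans (residue-≋ _) (≋-+ ≋-refl (residue-≋ _))) ≋-refl) (dot-⊕⊗ σ ρ y t))
          (cong (_% q) (lemma (toℕ a) (toℕ t) (toℕ r) (toℕ c) (dot σ y) (dot ρ y)))
    where lemma : ∀ a t r c d e → (a + t * r) * c + (d + t * e) ≡ a * c + d + t * (r * c + e)
          lemma = solve-∀

  dot-⊗ : ∀ {b} (ρ y : Vec (Fin q) b) t → dot (t ⊗ᵥ ρ) y ≋ (toℕ t * dot ρ y)
  dot-⊗ [] [] t = cong (_% q) (sym (*-zeroʳ (toℕ t)))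
  dot-⊗ (r ∷ ρ) (c ∷ y) t =
    trans (≋-+ (≋-* (residue-≋ _) ≋-refl) (dot-⊗ ρ y t))
          (cong (_% q) (lemma (toℕ t) (toℕ r) (toℕ c) (dot ρ y)))
    where lemma : ∀ t r c e → t * r * c + t * e ≡ t * (r * c + e)
          lemma = solve-∀

  negate : Fin q → Fin q
  negate c = residue (q ∸ toℕ c)

  +-negate≋0 : ∀ c → (toℕ c + toℕ (negate c)) ≋ 0
  +-negate≋0 c = trans (≋-+ {toℕ c} ≋-refl (residue-≋ (q ∸ toℕ c)))
                       (trans (cong (_% q) (m+[n∸m]≡n (<⇒≤ (Fin.toℕ<n c)))) (∣⇒≋0 ∣-refl))

  private
    ⊕-cancel : ∀ a c d → (toℕ c + toℕ d) ≋ 0 → (a ⊕ c) ⊕ d ≡ a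
    ⊕-cancel a c d e = ≋⇒toℕ-injective _ a toℕ≋
      where
      toℕ≋ : toℕ ((a ⊕ c) ⊕ d) ≋ toℕ a
      toℕ≋ = trans (residue-≋ _)
                (trans (≋-+ (residue-≋ (toℕ a + toℕ c)) (≋-refl {toℕ d}))
                (trans (cong (_% q) (+-assoc (toℕ a) (toℕ c) (toℕ d)))
                (trans (≋-+ {toℕ a} ≋-refl e) (cong (_% q) (+-identityʳ (toℕ a))))))

  ∑-translate : ∀ c (G : Fin q → ℕ) → ∑ (allFin q) (λ a → G (a ⊕ c)) ≡ ∑ (allFin q) G
  ∑-translate c = ∑-reindex (allFin q) (allFin q) (allFin-enumeration q) (allFin-enumeration q) (_⊕ c) (_⊕ negate c)
    (λ a → ⊕-cancel a c (negate c) (+-negate≋0 c))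
    (λ a → ⊕-cancel a (negate c) c (trans (cong (_% q) (+-comm (toℕ (negate c)) (toℕ c))) (+-negate≋0 c)))

  ∑-translateᵥ : ∀ b (w : Vec (Fin q) b) (G : Vec (Fin q) b → ℕ) →
    ∑ (vecsOf (allFin q) b) (λ σ → G (σ ⊕ᵥ w)) ≡ ∑ (vecsOf (allFin q) b) G
  ∑-translateᵥ zero [] G = refl
  ∑-translateᵥ (suc b) (w ∷ ws) G = begin
      ∑ (vecsOf (allFin q) (suc b)) (λ σ → G (σ ⊕ᵥ (w ∷ ws)))
    ≡⟨ ∑-vecsOf-suc (allFin q) b _ ⟩
      ∑ (allFin q) (λ x → ∑ (vecsOf (allFin q) b) (λ v → G ((x ⊕ w) ∷ (v ⊕ᵥ ws))))
    ≡⟨ ∑-cong (allFin q) (λ x → ∑-translateᵥ b ws (λ v → G ((x ⊕ w) ∷ v))) ⟩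
      ∑ (allFin q) (λ x → ∑ (vecsOf (allFin q) b) (λ v → G ((x ⊕ w) ∷ v)))
    ≡⟨ ∑-translate w (λ x → ∑ (vecsOf (allFin q) b) (λ v → G (x ∷ v))) ⟩
      ∑ (allFin q) (λ x → ∑ (vecsOf (allFin q) b) (λ v → G (x ∷ v)))
    ≡⟨ sym (∑-vecsOf-suc (allFin q) b G) ⟩
      ∑ (vecsOf (allFin q) (suc b)) G ∎
    where open ≡-Reasoning

  ∑-𝟙[c+d≋0]≡1 : ∀ d → ∑ (allFin q) (λ c → 𝟙 (does (q ∣? (toℕ c + d)))) ≡ 1
  ∑-𝟙[c+d≋0]≡1 d = begin
      ∑ (allFin q) (λ c → 𝟙 (does (q ∣? (toℕ c + d))))
    ≡⟨ ∑-cong (allFin q) (λ c → cong 𝟙 (does-∣-resp-≋ (≋-+ {toℕ c} ≋-refl (sym (residue-≋ d))))) ⟩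
      ∑ (allFin q) (λ c → 𝟙 (does (q ∣? (toℕ c + toℕ (residue d)))))
    ≡⟨ ∑-cong (allFin q) (λ c → cong 𝟙 (does-∣-resp-≋ (sym (residue-≋ (toℕ c + toℕ (residue d)))))) ⟩
      ∑ (allFin q) (λ c → 𝟙 (does (q ∣? toℕ (c ⊕ residue d))))
    ≡⟨ ∑-translate (residue d) (λ c → 𝟙 (does (q ∣? toℕ c))) ⟩
      ∑ (allFin q) (λ c → 𝟙 (does (q ∣? toℕ c)))
    ≡⟨ ∑-cong (allFin q) (λ c → cong 𝟙 (does-⇔ (mk⇔ (to c) (from c)) (q ∣? toℕ c) (c Fin.≟ residue 0))) ⟩
      ∑ (allFin q) (λ c → 𝟙 (does (c Fin.≟ residue 0)))
    ≡⟨ occurs-once (allFin-enumeration q) (residue 0) ⟩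
      1 ∎
    where
    open ≡-Reasoning
    to : ∀ c → q ∣ toℕ c → c ≡ residue 0
    to c d = ≋⇒toℕ-injective c (residue 0) (trans (∣⇒≋0 d) (sym (residue-≋ 0)))
    from : ∀ c → c ≡ residue 0 → q ∣ toℕ c
    from c refl = ∣-resp-≋ (sym (residue-≋ 0)) (q ∣0)

  -- A Bézout identity with the sign pattern -+ is turned into an inverse by multiplying by q - 1 ≡ -1.
  inverse : ∀ {n} → Coprime n q → Σ (Fin q) (λ v → (toℕ v * n) ≋ 1)
  inverse {n} c with coprime-Bézout c
  ... | Bézout.+- x y eq = residue x , trans (≋-* (residue-≋ x) (≋-refl {n}))
          (trans (cong (_% q) (sym eq)) (≋-+ {1} ≋-refl (∣⇒≋0 (n∣m*n y))))
  ... | Bézout.-+ x y eq = residue (pred q * x) , trans (≋-* (residue-≋ (pred q * x)) (≋-refl {n}))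
          (trans (sym ([m+n]%n≡m%n (pred q * x * n) q))
          (trans (cong (_% q) key) (≋-+ (∣⇒≋0 (∣n⇒∣m*n (pred q) (n∣m*n y))) (≋-refl {1}))))
    where
    key : pred q * x * n + q ≡ pred q * (y * q) + 1
    key = begin
        pred q * x * n + q
      ≡⟨ cong (pred q * x * n +_) (sym (suc-pred q)) ⟩
        pred q * x * n + suc (pred q)
      ≡⟨ lemma (pred q) x n ⟩
        pred q * (1 + x * n) + 1
      ≡⟨ cong (λ z → pred q * z + 1) eq ⟩
        pred q * (y * q) + 1 ∎
      where
      open ≡-Reasoning
      lemma : ∀ Q x u → Q * x * u + suc Q ≡ Q * (1 + x * u) + 1
      lemma = solve-∀

coprime-* : ∀ {a b n} → Coprime a n → Coprime b n → Coprime (a * b) n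
coprime-* ca cb (d∣ab , d∣n) = cb (coprime-divisor (λ { (e∣d , e∣a) → ca (e∣a , ∣-trans e∣d d∣n) }) d∣ab , d∣n)

coprime-^ : ∀ {a n} → Coprime a n → ∀ k → Coprime (a ^ k) n
coprime-^ c zero (d∣1 , _) = ∣1⇒≡1 d∣1
coprime-^ c (suc k) = coprime-* c (coprime-^ c k)

∧-≡-true : ∀ {a b} → a ∧ b ≡ true → a ≡ true × b ≡ true
∧-≡-true {true} {true} _ = refl , refl

-- Matrices over ℤ/p^s

module PrimePower (p : ℕ) (p-prime : Prime p) (s : ℕ) where

  instance
    p≢0 : NonZero p
    p≢0 = prime⇒nonZero p-prime

  q' : ℕ
  q' = p ^ s

  q : ℕ
  q = p * q'

  instance
    q'≢0 : NonZero q'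
    q'≢0 = m^n≢0 p s
    q≢0 : NonZero q
    q≢0 = m*n≢0 p q'

  open Residues q public

  p>1 : 1 < p
  p>1 = nonTrivial⇒n>1 p {{prime⇒nonTrivial p-prime}}

  p∣q : p ∣ q
  p∣q = m∣m*n q'

  V : (b : ℕ) → List (Vec (Fin q) b)
  V b = vecsOf (allFin q) b

  p∣ᵇ : Fin q → Bool
  p∣ᵇ e = does (p ∣? toℕ e)

  p∣ᵇ-residue : ∀ n → p∣ᵇ (residue n) ≡ does (p ∣? n)
  p∣ᵇ-residue n = trans (cong (λ z → does (p ∣? z)) (toℕ-residue n))
    (does-⇔ (mk⇔ (λ d → m%n≡0⇒n∣m n p (trans (sym (m∣n⇒o%n%m≡o%m p q n p∣q)) (n∣m⇒m%n≡0 (n % q) p d)))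
                 (λ d → m%n≡0⇒n∣m (n % q) p (trans (m∣n⇒o%n%m≡o%m p q n p∣q) (n∣m⇒m%n≡0 n p d))))
            (p ∣? (n % q)) (p ∣? n))

  p∣ᵇ-⊗ : ∀ t e → p∣ᵇ e ≡ true → p∣ᵇ (t ⊗ e) ≡ true
  p∣ᵇ-⊗ t e d = trans (p∣ᵇ-residue (toℕ t * toℕ e)) (dec-true (p ∣? _) (∣n⇒∣m*n (toℕ t) (from-does-true (p ∣? toℕ e) d)))

  p∣ᵇ-⊕⊗ : ∀ a t e → p∣ᵇ e ≡ true → p∣ᵇ (a ⊕ (t ⊗ e)) ≡ p∣ᵇ a
  p∣ᵇ-⊕⊗ a t e d = trans (p∣ᵇ-residue (toℕ a + toℕ (t ⊗ e)))
    (does-⇔ (mk⇔ (λ h → ∣m+n∣m⇒∣n (subst (p ∣_) (+-comm (toℕ a) _) h) p∣t⊗e) (λ h → ∣m∣n⇒∣m+n h p∣t⊗e))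
            (p ∣? (toℕ a + toℕ (t ⊗ e))) (p ∣? toℕ a))
    where
    p∣t⊗e : p ∣ toℕ (t ⊗ e)
    p∣t⊗e = from-does-true (p ∣? _) (p∣ᵇ-⊗ t e d)

  -- Fin q ≅ Fin q' × Fin p via (a, r) ↦ p a + r, so that the multiples of p are exactly the residues with r = 0.
  split : Fin q' → Fin p → Fin q
  split a r = cast (*-comm q' p) (combine a r)

  toℕ-split : ∀ a r → toℕ (split a r) ≡ p * toℕ a + toℕ r
  toℕ-split a r = trans (Fin.toℕ-cast (*-comm q' p) (combine a r)) (Fin.toℕ-combine a r)

  ∑-split : ∀ (G : Fin q → ℕ) → ∑ (allFin q) G ≡ ∑ (allFin q') (λ a → ∑ (allFin p) (λ r → G (split a r)))
  ∑-split G = trans (∑-allFin-cast (*-comm q' p) G) (∑-allFin-combine q' p (λ x → G (cast (*-comm q' p) x)))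

  0ᵖ : Fin p
  0ᵖ = fromℕ< (>-nonZero⁻¹ p)

  p*_ : Fin q' → Fin q
  p* a = split a 0ᵖ

  toℕ-p* : ∀ a → toℕ (p* a) ≡ p * toℕ a
  toℕ-p* a = trans (toℕ-split a _) (trans (cong (p * toℕ a +_) (Fin.toℕ-fromℕ< (>-nonZero⁻¹ p))) (+-identityʳ _))

  p∣ᵇ-split : ∀ a r → p∣ᵇ (split a r) ≡ does (r Fin.≟ 0ᵖ)
  p∣ᵇ-split a r = does-⇔ (mk⇔ to from) (p ∣? toℕ (split a r)) (r Fin.≟ _)
    where
    to : p ∣ toℕ (split a r) → r ≡ 0ᵖ
    to d with toℕ r in eqr
    ... | zero = Fin.toℕ-injective (trans eqr (sym (Fin.toℕ-fromℕ< (>-nonZero⁻¹ p))))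
    ... | suc k = ⊥-elim (<⇒≱ (subst (_< p) eqr (Fin.toℕ<n r))
                    (∣⇒≤ (subst (p ∣_) eqr (∣m+n∣m⇒∣n (subst (p ∣_) (toℕ-split a r) d) (m∣m*n (toℕ a))))))
    from : r ≡ 0ᵖ → p ∣ toℕ (split a r)
    from refl = subst (p ∣_) (sym (toℕ-p* a)) (m∣m*n (toℕ a))

  ∑-multiples-of-p : ∀ (G : Fin q → ℕ) → ∑ (allFin q) (λ e → 𝟙 (p∣ᵇ e) * G e) ≡ ∑ (allFin q') (λ a → G (p* a))
  ∑-multiples-of-p G = trans (∑-split _) (∑-cong (allFin q') (λ a →
    trans (∑-cong (allFin p) (λ r → cong (λ z → 𝟙 z * G (split a r)) (p∣ᵇ-split a r)))
          (∑-select Fin._≟_ (allFin p) (allFin-enumeration p) _ (λ r → G (split a r)))))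

  #multiples-of-p : ∑ (allFin q) (λ e → 𝟙 (p∣ᵇ e)) ≡ q'
  #multiples-of-p = trans (∑-cong (allFin q) (λ e → sym (*-identityʳ (𝟙 (p∣ᵇ e)))))
                          (trans (∑-multiples-of-p (λ _ → 1)) (∑-allFin-1 q'))

  #units : ℕ
  #units = ∑ (allFin q) (λ e → 𝟙 (not (p∣ᵇ e)))

  ¬p∣⇒coprime : ∀ {n} → ¬ p ∣ n → Coprime n q
  ¬p∣⇒coprime {n} ¬p∣n = Data.Nat.Coprimality.sym (coprime-* coprime-p (coprime-^ coprime-p s))
    where
    coprime-p : Coprime p n
    coprime-p (i∣p , i∣n) with prime⇒irreducible p-prime i∣p
    ... | inj₁ i≡1 = i≡1
    ... | inj₂ refl = ⊥-elim (¬p∣n i∣n)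

  unit-inverse : ∀ u → p∣ᵇ u ≡ false → Σ (Fin q) (λ v → (toℕ v * toℕ u) ≋ 1)
  unit-inverse u h = inverse (¬p∣⇒coprime (from-does-false (p ∣? toℕ u) h))

  prefixDivᵇ : ∀ {b} → ℕ → Vec (Fin q) b → Bool
  prefixDivᵇ zero _ = true
  prefixDivᵇ (suc k) [] = true
  prefixDivᵇ (suc k) (x ∷ xs) = p∣ᵇ x ∧ prefixDivᵇ k xs

  colsDivᵇ : ∀ {a b} → ℕ → Vec (Vec (Fin q) b) a → Bool
  colsDivᵇ k [] = true
  colsDivᵇ k (r ∷ A) = prefixDivᵇ k r ∧ colsDivᵇ k A

  prefixDivᵇ-insertAt : ∀ {b} (σ : Vec (Fin q) b) ι a → prefixDivᵇ (toℕ ι) (insertAt σ ι a) ≡ prefixDivᵇ (toℕ ι) σ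
  prefixDivᵇ-insertAt σ fzero a = refl
  prefixDivᵇ-insertAt (x ∷ σ) (fsuc ι) a = cong (p∣ᵇ x ∧_) (prefixDivᵇ-insertAt σ ι a)

  prefixDivᵇ-suc-insertAt : ∀ {b} (σ : Vec (Fin q) b) ι a →
    prefixDivᵇ (suc (toℕ ι)) (insertAt σ ι a) ≡ prefixDivᵇ (toℕ ι) σ ∧ p∣ᵇ a
  prefixDivᵇ-suc-insertAt σ fzero a = ∧-identityʳ (p∣ᵇ a)
  prefixDivᵇ-suc-insertAt (x ∷ σ) (fsuc ι) a =
    trans (cong (p∣ᵇ x ∧_) (prefixDivᵇ-suc-insertAt σ ι a)) (sym (∧-assoc (p∣ᵇ x) _ (p∣ᵇ a)))

  prefixDivᵇ-suc⇒ : ∀ {b} k (σ : Vec (Fin q) b) → prefixDivᵇ (suc k) σ ≡ true → prefixDivᵇ k σ ≡ true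
  prefixDivᵇ-suc⇒ zero σ _ = refl
  prefixDivᵇ-suc⇒ (suc k) [] _ = refl
  prefixDivᵇ-suc⇒ (suc k) (x ∷ σ) e with ∧-≡-true {p∣ᵇ x} e
  ... | e₁ , e₂ = cong₂ _∧_ e₁ (prefixDivᵇ-suc⇒ k σ e₂)

  colsDivᵇ-suc⇒ : ∀ {a b} k (A : Vec (Vec (Fin q) b) a) → colsDivᵇ (suc k) A ≡ true → colsDivᵇ k A ≡ true
  colsDivᵇ-suc⇒ k [] _ = refl
  colsDivᵇ-suc⇒ k (r ∷ A) e with ∧-≡-true {prefixDivᵇ (suc k) r} e
  ... | e₁ , e₂ = cong₂ _∧_ (prefixDivᵇ-suc⇒ k r e₁) (colsDivᵇ-suc⇒ k A e₂)

  colsDivᵇ-++ : ∀ {a c b} k (A : Vec (Vec (Fin q) b) a) (B : Vec (Vec (Fin q) b) c) →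
    colsDivᵇ k (A ++ᵥ B) ≡ colsDivᵇ k A ∧ colsDivᵇ k B
  colsDivᵇ-++ k [] B = refl
  colsDivᵇ-++ k (r ∷ A) B = trans (cong (prefixDivᵇ k r ∧_) (colsDivᵇ-++ k A B)) (sym (∧-assoc (prefixDivᵇ k r) _ _))

  prefixDivᵇ-⊕⊗ : ∀ {b} k (σ ρ : Vec (Fin q) b) t → prefixDivᵇ k ρ ≡ true → prefixDivᵇ k (σ ⊕ᵥ (t ⊗ᵥ ρ)) ≡ prefixDivᵇ k σ
  prefixDivᵇ-⊕⊗ zero σ ρ t _ = refl
  prefixDivᵇ-⊕⊗ (suc k) [] [] t _ = refl
  prefixDivᵇ-⊕⊗ (suc k) (x ∷ σ) (r ∷ ρ) t e with ∧-≡-true {p∣ᵇ r} e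
  ... | e₁ , e₂ = cong₂ _∧_ (p∣ᵇ-⊕⊗ x t r e₁) (prefixDivᵇ-⊕⊗ k σ ρ t e₂)

  prefixDivᵇ-⊗ : ∀ {b} k (ρ : Vec (Fin q) b) t → prefixDivᵇ k ρ ≡ true → prefixDivᵇ k (t ⊗ᵥ ρ) ≡ true
  prefixDivᵇ-⊗ zero ρ t _ = refl
  prefixDivᵇ-⊗ (suc k) [] t _ = refl
  prefixDivᵇ-⊗ (suc k) (r ∷ ρ) t e with ∧-≡-true {p∣ᵇ r} e
  ... | e₁ , e₂ = cong₂ _∧_ (p∣ᵇ-⊗ t r e₁) (prefixDivᵇ-⊗ k ρ t e₂)

  #prefixDiv : ∀ b k → k ≤ b → ∑ (V b) (λ σ → 𝟙 (prefixDivᵇ k σ)) ≡ q' ^ k * q ^ (b ∸ k)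
  #prefixDiv b zero _ = begin
      ∑ (V b) (λ _ → 1)
    ≡⟨ ∑-vecsOf-const (allFin q) b 1 ⟩
      length (allFin q) ^ b * 1
    ≡⟨ cong (λ n → n ^ b * 1) (List.length-tabulate (λ x → x)) ⟩
      q ^ b * 1
    ≡⟨ trans (*-identityʳ _) (sym (+-identityʳ _)) ⟩
      1 * q ^ b ∎
    where open ≡-Reasoning
  #prefixDiv (suc b) (suc k) (s≤s k≤b) = begin
      ∑ (V (suc b)) (λ σ → 𝟙 (prefixDivᵇ (suc k) σ))
    ≡⟨ ∑-vecsOf-suc (allFin q) b _ ⟩
      ∑ (allFin q) (λ t → ∑ (V b) (λ σ → 𝟙 (p∣ᵇ t ∧ prefixDivᵇ k σ)))
    ≡⟨ ∑-cong (allFin q) (λ t → trans (∑-cong (V b) (λ σ → 𝟙-∧ (p∣ᵇ t) (prefixDivᵇ k σ))) (∑-*ˡ (V b) (𝟙 (p∣ᵇ t)) _)) ⟩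
      ∑ (allFin q) (λ t → 𝟙 (p∣ᵇ t) * ∑ (V b) (λ σ → 𝟙 (prefixDivᵇ k σ)))
    ≡⟨ ∑-*ʳ (allFin q) _ (λ t → 𝟙 (p∣ᵇ t)) ⟩
      ∑ (allFin q) (λ t → 𝟙 (p∣ᵇ t)) * ∑ (V b) (λ σ → 𝟙 (prefixDivᵇ k σ))
    ≡⟨ cong₂ _*_ #multiples-of-p (#prefixDiv b k k≤b) ⟩
      q' * (q' ^ k * q ^ (b ∸ k))
    ≡⟨ sym (*-assoc q' _ _) ⟩
      q' ^ suc k * q ^ (b ∸ k) ∎
    where open ≡-Reasoning

  #allDiv : ∀ k → ∑ (V k) (λ T → 𝟙 (prefixDivᵇ k T)) ≡ q' ^ k
  #allDiv k = trans (#prefixDiv k k ≤-refl) (trans (cong (λ n → q' ^ k * q ^ n) (n∸n≡0 k)) (*-identityʳ _))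

  private
    and-allFin-suc : ∀ n (f : Fin (suc n) → Bool) → and (map f (allFin (suc n))) ≡ f fzero ∧ and (map (λ c → f (fsuc c)) (allFin n))
    and-allFin-suc n f = cong (λ L → f fzero ∧ and L) (trans (List.map-tabulate fsuc f) (sym (List.map-tabulate (λ x → x) (λ c → f (fsuc c)))))

    and-true : ∀ {A : Set} (L : List A) → and (map (λ _ → true) L) ≡ true
    and-true [] = refl
    and-true (x ∷ L) = and-true L

    colDiv-zero : ∀ {a b} (A : Vec (Vec (Fin q) (suc b)) a) → colDiv p A fzero ≡ colsDivᵇ 1 A
    colDiv-zero [] = refl
    colDiv-zero ((x ∷ xs) ∷ A) = cong₂ _∧_ (sym (∧-identityʳ (p∣ᵇ x))) (colDiv-zero A)

    colDiv-suc : ∀ {a b} (A : Vec (Vec (Fin q) (suc b)) a) c → colDiv p A (fsuc c) ≡ colDiv p (vmap tail A) c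
    colDiv-suc [] c = refl
    colDiv-suc ((x ∷ xs) ∷ A) c = cong (does (p ∣? toℕ (lookup xs c)) ∧_) (colDiv-suc A c)

    colsDivᵇ-zero : ∀ {a b} (A : Vec (Vec (Fin q) b) a) → colsDivᵇ 0 A ≡ true
    colsDivᵇ-zero [] = refl
    colsDivᵇ-zero (r ∷ A) = colsDivᵇ-zero A

    colsDivᵇ-suc : ∀ {a b} k (A : Vec (Vec (Fin q) (suc b)) a) → colsDivᵇ (suc k) A ≡ colsDivᵇ 1 A ∧ colsDivᵇ k (vmap tail A)
    colsDivᵇ-suc k [] = refl
    colsDivᵇ-suc k ((x ∷ xs) ∷ A) = trans (cong ((p∣ᵇ x ∧ prefixDivᵇ k xs) ∧_) (colsDivᵇ-suc k A))
                                          (shuffle (p∣ᵇ x) (prefixDivᵇ k xs) (colsDivᵇ 1 A) (colsDivᵇ k (vmap tail A)))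
      where
      shuffle : ∀ a b c d → (a ∧ b) ∧ (c ∧ d) ≡ ((a ∧ true) ∧ c) ∧ (b ∧ d)
      shuffle true true c d = refl
      shuffle true false true d = refl
      shuffle true false false d = refl
      shuffle false b c d = refl

    guard-∧ : ∀ lt c G D D' → lt ∧ G ≡ lt ∧ (D ∧ not D') → lt ∧ (c ∧ G) ≡ lt ∧ ((c ∧ D) ∧ not (c ∧ D'))
    guard-∧ lt true G D D' h = h
    guard-∧ true false G D D' h = refl
    guard-∧ false false G D D' h = refl

  firstCol-colsDivᵇ : ∀ {a} b k (A : Vec (Vec (Fin q) b) a) →
    firstCol p A k ≡ (k <ᵇ b) ∧ (colsDivᵇ k A ∧ not (colsDivᵇ (suc k) A))
  firstCol-colsDivᵇ zero k A = refl
  firstCol-colsDivᵇ (suc b) zero A = begin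
      firstCol p A 0
    ≡⟨ and-allFin-suc b _ ⟩
      not (colDiv p A fzero) ∧ and (map (λ _ → true) (allFin b))
    ≡⟨ trans (cong (not (colDiv p A fzero) ∧_) (and-true (allFin b))) (∧-identityʳ _) ⟩
      not (colDiv p A fzero)
    ≡⟨ cong not (colDiv-zero A) ⟩
      not (colsDivᵇ 1 A)
    ≡⟨ cong (_∧ not (colsDivᵇ 1 A)) (sym (colsDivᵇ-zero A)) ⟩
      colsDivᵇ 0 A ∧ not (colsDivᵇ 1 A) ∎
    where open ≡-Reasoning
  firstCol-colsDivᵇ (suc b) (suc k) A = begin
      firstCol p A (suc k)
    ≡⟨ cong ((k <ᵇ b) ∧_) (and-allFin-suc b _) ⟩
      (k <ᵇ b) ∧ (colDiv p A fzero ∧ and (map (λ c → column c (colDiv p A (fsuc c))) (allFin b)))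
    ≡⟨ cong (λ z → (k <ᵇ b) ∧ (colDiv p A fzero ∧ and z)) (List.map-cong (λ c → cong (column c) (colDiv-suc A c)) (allFin b)) ⟩
      (k <ᵇ b) ∧ (colDiv p A fzero ∧ and (map (λ c → column c (colDiv p (vmap tail A) c)) (allFin b)))
    ≡⟨ guard-∧ (k <ᵇ b) (colDiv p A fzero) _ (colsDivᵇ k (vmap tail A)) _ (firstCol-colsDivᵇ b k (vmap tail A)) ⟩
      (k <ᵇ b) ∧ ((colDiv p A fzero ∧ colsDivᵇ k (vmap tail A)) ∧ not (colDiv p A fzero ∧ colsDivᵇ (suc k) (vmap tail A)))
    ≡⟨ cong (λ z → (k <ᵇ b) ∧ ((z ∧ colsDivᵇ k (vmap tail A)) ∧ not (z ∧ colsDivᵇ (suc k) (vmap tail A)))) (colDiv-zero A) ⟩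
      (k <ᵇ b) ∧ ((colsDivᵇ 1 A ∧ colsDivᵇ k (vmap tail A)) ∧ not (colsDivᵇ 1 A ∧ colsDivᵇ (suc k) (vmap tail A)))
    ≡⟨ sym (cong₂ (λ x y → (k <ᵇ b) ∧ (x ∧ not y)) (colsDivᵇ-suc k A) (colsDivᵇ-suc (suc k) A)) ⟩
      (k <ᵇ b) ∧ (colsDivᵇ (suc k) A ∧ not (colsDivᵇ (suc (suc k)) A)) ∎
    where
    open ≡-Reasoning
    column : Fin b → Bool → Bool
    column c z = if toℕ c <ᵇ k then z else (if toℕ c ≡ᵇ k then not z else true)

  coprimeᵇ-q : ∀ y → (gcd y q ≡ᵇ 1) ≡ not (does (p ∣? y))
  coprimeᵇ-q y with p ∣? y
  ... | yes p∣y = dec-false (gcd y q ≟ 1) (λ e → <⇒≢ p>1 (sym (∣1⇒≡1 (subst (p ∣_) e (gcd-greatest p∣y p∣q)))))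
  ... | no ¬p∣y rewrite coprime⇒gcd≡1 (¬p∣⇒coprime ¬p∣y) = refl

  private
    ∑-residues-from-1 : ∀ (h : Bool → ℕ) → ∑ (map suc (upTo q)) (λ x → h (does (p ∣? x))) ≡ ∑ (allFin q) (λ e → h (p∣ᵇ e))
    ∑-residues-from-1 h = begin
        ∑ (map suc (upTo q)) (λ x → h (does (p ∣? x)))
      ≡⟨ ∑-map suc (upTo q) _ ⟩
        ∑ (upTo q) (λ x → h (does (p ∣? suc x)))
      ≡⟨ ∑-upTo-rotate q (λ x → h (does (p ∣? x))) (cong h (trans (dec-true (p ∣? q) p∣q) (sym (dec-true (p ∣? 0) (p ∣0))))) ⟩
        ∑ (upTo q) (λ x → h (does (p ∣? x)))
      ≡⟨ sym (∑-allFin-toℕ q (λ x → h (does (p ∣? x)))) ⟩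
        ∑ (allFin q) (λ e → h (p∣ᵇ e)) ∎
      where open ≡-Reasoning

  φ-suc : ∀ u → φ (suc u) q ≡ #units * q ^ u + q' * φ u q
  φ-suc u = begin
      φ (suc u) q
    ≡⟨ count≡∑𝟙 coprime-entry (vecsOf L (suc u)) ⟩
      ∑ (vecsOf L (suc u)) (λ v → 𝟙 (coprime-entry v))
    ≡⟨ ∑-vecsOf-suc L u _ ⟩
      ∑ L (λ x → ∑ (vecsOf L u) (λ v → 𝟙 ((gcd x q ≡ᵇ 1) ∨ coprime-entry v)))
    ≡⟨ ∑-cong L (λ x → by-head (gcd x q ≡ᵇ 1)) ⟩
      ∑ L (λ x → 𝟙 (gcd x q ≡ᵇ 1) * q ^ u + 𝟙 (not (gcd x q ≡ᵇ 1)) * φ u q)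
    ≡⟨ ∑-+ L _ _ ⟩
      ∑ L (λ x → 𝟙 (gcd x q ≡ᵇ 1) * q ^ u) + ∑ L (λ x → 𝟙 (not (gcd x q ≡ᵇ 1)) * φ u q)
    ≡⟨ cong₂ _+_ (trans (∑-*ʳ L (q ^ u) _) (cong (_* q ^ u) #coprime))
                 (trans (∑-*ʳ L (φ u q) _) (cong (_* φ u q) #non-coprime)) ⟩
      #units * q ^ u + q' * φ u q ∎
    where
    open ≡-Reasoning
    L : List ℕ
    L = map suc (upTo q)
    coprime-entry : ∀ {u} → Vec ℕ u → Bool
    coprime-entry = Data.Vec.foldr _ (λ x acc → (gcd x q ≡ᵇ 1) ∨ acc) false
    #coprime : ∑ L (λ x → 𝟙 (gcd x q ≡ᵇ 1)) ≡ #units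
    #coprime = trans (∑-cong L (λ x → cong 𝟙 (coprimeᵇ-q x))) (∑-residues-from-1 (λ z → 𝟙 (not z)))
    #non-coprime : ∑ L (λ x → 𝟙 (not (gcd x q ≡ᵇ 1))) ≡ q'
    #non-coprime = trans (∑-cong L (λ x → cong (λ z → 𝟙 (not z)) (coprimeᵇ-q x)))
      (trans (∑-residues-from-1 (λ z → 𝟙 (not (not z)))) (trans (∑-cong (allFin q) (λ e → cong 𝟙 (not-involutive (p∣ᵇ e)))) #multiples-of-p))
    by-head : ∀ c → ∑ (vecsOf L u) (λ v → 𝟙 (c ∨ coprime-entry v)) ≡ 𝟙 c * q ^ u + 𝟙 (not c) * φ u q
    by-head true = trans (∑-vecsOf-const L u 1)
      (trans (cong (λ n → n ^ u * 1) (trans (List.length-map suc (upTo q)) (List.length-upTo q))) (trans (*-identityʳ _) (sym (trans (+-identityʳ _) (+-identityʳ _)))))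
    by-head false = trans (sym (count≡∑𝟙 coprime-entry (vecsOf L u))) (sym (+-identityʳ _))

  rowSolᵇ : ∀ {b} → Vec (Fin q) b → Vec (Fin q) b → Bool
  rowSolᵇ r x = does (q ∣? dot r x)

  nSol-∑ : ∀ {a b} (A : Vec (Vec (Fin q) b) a) → nSol A ≡ ∑ (V b) (λ x → 𝟙 (isSol A x))
  nSol-∑ {b = b} A = count≡∑𝟙 (isSol A) (V b)

  isSol-++ : ∀ {a c b} (A : Vec (Vec (Fin q) b) a) (B : Vec (Vec (Fin q) b) c) x →
    isSol (A ++ᵥ B) x ≡ isSol A x ∧ isSol B x
  isSol-++ [] B x = refl
  isSol-++ (r ∷ A) B x = trans (cong (rowSolᵇ r x ∧_) (isSol-++ A B x)) (sym (∧-assoc (rowSolᵇ r x) _ _))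

  isSol-middle : ∀ {a c b} (A : Vec (Vec (Fin q) b) a) r (B : Vec (Vec (Fin q) b) c) x →
    isSol (A ++ᵥ r ∷ B) x ≡ rowSolᵇ r x ∧ isSol (A ++ᵥ B) x
  isSol-middle [] r B x = refl
  isSol-middle (a ∷ A) r B x = trans (cong (rowSolᵇ a x ∧_) (isSol-middle A r B x)) (∧-swap (rowSolᵇ a x) (rowSolᵇ r x) _)
    where
    ∧-swap : ∀ a b c → a ∧ (b ∧ c) ≡ b ∧ (a ∧ c)
    ∧-swap true b c = refl
    ∧-swap false true c = refl
    ∧-swap false false c = refl

  nSol-middle : ∀ {a c b} (A : Vec (Vec (Fin q) b) a) r (B : Vec (Vec (Fin q) b) c) → nSol (A ++ᵥ r ∷ B) ≡ nSol (r ∷ (A ++ᵥ B))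
  nSol-middle {b = b} A r B = trans (nSol-∑ (A ++ᵥ r ∷ B))
    (trans (∑-cong (V b) (λ x → cong 𝟙 (isSol-middle A r B x))) (sym (nSol-∑ (r ∷ (A ++ᵥ B)))))

  nSol-replace-row : ∀ {k n b} (P : Vec (Vec (Fin q) b) k) r r' (R : Vec (Vec (Fin q) b) n) →
    (∀ x → rowSolᵇ r x ≡ rowSolᵇ r' x) → nSol (P ++ᵥ r ∷ R) ≡ nSol (P ++ᵥ r' ∷ R)
  nSol-replace-row {b = b} P r r' R h = begin
      nSol (P ++ᵥ r ∷ R)
    ≡⟨ nSol-∑ (P ++ᵥ r ∷ R) ⟩
      ∑ (V b) (λ x → 𝟙 (isSol (P ++ᵥ r ∷ R) x))
    ≡⟨ ∑-cong (V b) (λ x → cong 𝟙 (trans (isSol-middle P r R x)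
         (trans (cong (_∧ isSol (P ++ᵥ R) x) (h x)) (sym (isSol-middle P r' R x))))) ⟩
      ∑ (V b) (λ x → 𝟙 (isSol (P ++ᵥ r' ∷ R) x))
    ≡⟨ sym (nSol-∑ (P ++ᵥ r' ∷ R)) ⟩
      nSol (P ++ᵥ r' ∷ R) ∎
    where open ≡-Reasoning

  rowSolᵇ-unit-⊗ : ∀ {b} (r x : Vec (Fin q) b) (v u : Fin q) → (toℕ v * toℕ u) ≋ 1 → rowSolᵇ (v ⊗ᵥ r) x ≡ rowSolᵇ r x
  rowSolᵇ-unit-⊗ r x v u vu =
    trans (does-∣-resp-≋ (dot-⊗ r x v)) (does-⇔ (mk⇔ cancel (∣n⇒∣m*n (toℕ v))) (q ∣? (toℕ v * dot r x)) (q ∣? dot r x))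
    where
    cancel : q ∣ toℕ v * dot r x → q ∣ dot r x
    cancel d = ∣-resp-≋ (trans (cong (_% q) (lemma (toℕ u) (toℕ v) (dot r x)))
                               (trans (≋-* vu (≋-refl {dot r x})) (cong (_% q) (*-identityˡ (dot r x)))))
                        (∣n⇒∣m*n (toℕ u) d)
      where lemma : ∀ u v d → u * (v * d) ≡ v * u * d
            lemma = solve-∀

  module R' = Residues q'

  V' : (b : ℕ) → List (Vec (Fin q') b)
  V' b = vecsOf (allFin q') b

  ∑-allDiv-row : ∀ b (G : Vec (Fin q) b → ℕ) → ∑ (V b) (λ σ → 𝟙 (prefixDivᵇ b σ) * G σ) ≡ ∑ (V' b) (λ σ → G (vmap p*_ σ))
  ∑-allDiv-row zero G = cong (_+ 0) (+-identityʳ (G []))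
  ∑-allDiv-row (suc b) G = begin
      ∑ (V (suc b)) (λ σ → 𝟙 (prefixDivᵇ (suc b) σ) * G σ)
    ≡⟨ ∑-vecsOf-suc (allFin q) b _ ⟩
      ∑ (allFin q) (λ x → ∑ (V b) (λ σ → 𝟙 (p∣ᵇ x ∧ prefixDivᵇ b σ) * G (x ∷ σ)))
    ≡⟨ ∑-cong (allFin q) (λ x → trans (∑-cong (V b) (λ σ → trans (cong (_* G (x ∷ σ)) (𝟙-∧ (p∣ᵇ x) _)) (*-assoc (𝟙 (p∣ᵇ x)) _ _)))
                                      (∑-*ˡ (V b) (𝟙 (p∣ᵇ x)) _)) ⟩
      ∑ (allFin q) (λ x → 𝟙 (p∣ᵇ x) * ∑ (V b) (λ σ → 𝟙 (prefixDivᵇ b σ) * G (x ∷ σ)))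
    ≡⟨ ∑-cong (allFin q) (λ x → cong (𝟙 (p∣ᵇ x) *_) (∑-allDiv-row b (λ σ → G (x ∷ σ)))) ⟩
      ∑ (allFin q) (λ x → 𝟙 (p∣ᵇ x) * ∑ (V' b) (λ σ → G (x ∷ vmap p*_ σ)))
    ≡⟨ ∑-multiples-of-p _ ⟩
      ∑ (allFin q') (λ a → ∑ (V' b) (λ σ → G (p* a ∷ vmap p*_ σ)))
    ≡⟨ sym (∑-vecsOf-suc (allFin q') b _) ⟩
      ∑ (V' (suc b)) (λ σ → G (vmap p*_ σ)) ∎
    where open ≡-Reasoning

  ∑-allDiv : ∀ b l (G : Vec (Vec (Fin q) b) l → ℕ) →
    ∑ (vecsOf (V b) l) (λ B → 𝟙 (colsDivᵇ b B) * G B) ≡ ∑ (vecsOf (V' b) l) (λ B → G (vmap (vmap p*_) B))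
  ∑-allDiv b zero G = cong (_+ 0) (+-identityʳ (G []))
  ∑-allDiv b (suc l) G = begin
      ∑ (vecsOf (V b) (suc l)) (λ B → 𝟙 (colsDivᵇ b B) * G B)
    ≡⟨ ∑-vecsOf-suc (V b) l _ ⟩
      ∑ (V b) (λ r → ∑ (vecsOf (V b) l) (λ B → 𝟙 (prefixDivᵇ b r ∧ colsDivᵇ b B) * G (r ∷ B)))
    ≡⟨ ∑-cong (V b) (λ r → trans (∑-cong (vecsOf (V b) l) (λ B → trans (cong (_* G (r ∷ B)) (𝟙-∧ (prefixDivᵇ b r) _)) (*-assoc (𝟙 (prefixDivᵇ b r)) _ _)))
                                 (∑-*ˡ (vecsOf (V b) l) (𝟙 (prefixDivᵇ b r)) _)) ⟩
      ∑ (V b) (λ r → 𝟙 (prefixDivᵇ b r) * ∑ (vecsOf (V b) l) (λ B → 𝟙 (colsDivᵇ b B) * G (r ∷ B)))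
    ≡⟨ ∑-cong (V b) (λ r → cong (𝟙 (prefixDivᵇ b r) *_) (∑-allDiv b l (λ B → G (r ∷ B)))) ⟩
      ∑ (V b) (λ r → 𝟙 (prefixDivᵇ b r) * ∑ (vecsOf (V' b) l) (λ B → G (r ∷ vmap (vmap p*_) B)))
    ≡⟨ ∑-allDiv-row b _ ⟩
      ∑ (V' b) (λ r → ∑ (vecsOf (V' b) l) (λ B → G (vmap p*_ r ∷ vmap (vmap p*_) B)))
    ≡⟨ sym (∑-vecsOf-suc (V' b) l _) ⟩
      ∑ (vecsOf (V' b) (suc l)) (λ B → G (vmap (vmap p*_) B)) ∎
    where open ≡-Reasoning

  reduce : Fin q → Fin q'
  reduce e = R'.residue (toℕ e)

  ∑-reduce : ∀ (K : Fin q' → ℕ) → ∑ (allFin q) (λ e → K (reduce e)) ≡ p * ∑ (allFin q') K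
  ∑-reduce K = begin
      ∑ (allFin q) (λ e → K (reduce e))
    ≡⟨ ∑-allFin-combine p q' _ ⟩
      ∑ (allFin p) (λ r → ∑ (allFin q') (λ a → K (reduce (combine r a))))
    ≡⟨ ∑-cong (allFin p) (λ r → ∑-cong (allFin q') (λ a → cong K (reduce-combine r a))) ⟩
      ∑ (allFin p) (λ _ → ∑ (allFin q') K)
    ≡⟨ trans (∑-const (allFin p) _) (cong (_* ∑ (allFin q') K) (List.length-tabulate {n = p} (λ x → x))) ⟩
      p * ∑ (allFin q') K ∎
    where
    open ≡-Reasoning
    reduce-combine : ∀ (r : Fin p) (a : Fin q') → reduce (combine r a) ≡ a
    reduce-combine r a = Fin.toℕ-injective (begin
        toℕ (R'.residue (toℕ (combine r a)))
      ≡⟨ R'.toℕ-residue _ ⟩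
        toℕ (combine r a) % q'
      ≡⟨ cong (_% q') (trans (Fin.toℕ-combine r a) (trans (+-comm (q' * toℕ r) (toℕ a)) (cong (toℕ a +_) (*-comm q' (toℕ r))))) ⟩
        (toℕ a + toℕ r * q') % q'
      ≡⟨ [m+kn]%n≡m%n (toℕ a) (toℕ r) q' ⟩
        toℕ a % q'
      ≡⟨ m<n⇒m%n≡m (Fin.toℕ<n a) ⟩
        toℕ a ∎)

  ∑-reduceᵥ : ∀ b (H : Vec (Fin q') b → ℕ) → ∑ (V b) (λ x → H (vmap reduce x)) ≡ p ^ b * ∑ (V' b) H
  ∑-reduceᵥ zero H = sym (+-identityʳ _)
  ∑-reduceᵥ (suc b) H = begin
      ∑ (V (suc b)) (λ x → H (vmap reduce x))
    ≡⟨ ∑-vecsOf-suc (allFin q) b _ ⟩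
      ∑ (allFin q) (λ e → ∑ (V b) (λ x → H (reduce e ∷ vmap reduce x)))
    ≡⟨ ∑-cong (allFin q) (λ e → ∑-reduceᵥ b (λ y → H (reduce e ∷ y))) ⟩
      ∑ (allFin q) (λ e → p ^ b * ∑ (V' b) (λ y → H (reduce e ∷ y)))
    ≡⟨ ∑-reduce (λ a → p ^ b * ∑ (V' b) (λ y → H (a ∷ y))) ⟩
      p * ∑ (allFin q') (λ a → p ^ b * ∑ (V' b) (λ y → H (a ∷ y)))
    ≡⟨ cong (p *_) (∑-*ˡ (allFin q') (p ^ b) _) ⟩
      p * (p ^ b * ∑ (allFin q') (λ a → ∑ (V' b) (λ y → H (a ∷ y))))
    ≡⟨ sym (*-assoc p (p ^ b) _) ⟩
      p ^ suc b * ∑ (allFin q') (λ a → ∑ (V' b) (λ y → H (a ∷ y)))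
    ≡⟨ cong (p ^ suc b *_) (sym (∑-vecsOf-suc (allFin q') b H)) ⟩
      p ^ suc b * ∑ (V' (suc b)) H ∎
    where open ≡-Reasoning

  mixedDot : ∀ {b} → Vec (Fin q') b → Vec (Fin q) b → ℕ
  mixedDot [] [] = 0
  mixedDot (u ∷ r) (v ∷ x) = toℕ u * toℕ v + mixedDot r x

  dot-p* : ∀ {b} (r : Vec (Fin q') b) (x : Vec (Fin q) b) → dot (vmap p*_ r) x ≡ p * mixedDot r x
  dot-p* [] [] = sym (*-zeroʳ p)
  dot-p* (u ∷ r) (v ∷ x) = trans (cong₂ _+_ (cong (_* toℕ v) (toℕ-p* u)) (dot-p* r x))
    (trans (cong (_+ p * mixedDot r x) (*-assoc p (toℕ u) (toℕ v))) (sym (*-distribˡ-+ p _ _)))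

  mixedDot-reduce : ∀ {b} (r : Vec (Fin q') b) (x : Vec (Fin q) b) → mixedDot r x R'.≋ dot r (vmap reduce x)
  mixedDot-reduce [] [] = refl
  mixedDot-reduce (u ∷ r) (v ∷ x) = R'.≋-+ (R'.≋-* (R'.≋-refl {toℕ u}) (sym (R'.residue-≋ (toℕ v)))) (mixedDot-reduce r x)

  isSol-p* : ∀ {a b} (B : Vec (Vec (Fin q') b) a) (x : Vec (Fin q) b) → isSol (vmap (vmap p*_) B) x ≡ isSol B (vmap reduce x)
  isSol-p* [] x = refl
  isSol-p* (r ∷ B) x = cong₂ _∧_ row (isSol-p* B x)
    where
    row : does (q ∣? dot (vmap p*_ r) x) ≡ does (q' ∣? dot r (vmap reduce x))
    row = trans (cong (λ z → does (q ∣? z)) (dot-p* r x))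
      (trans (does-⇔ (mk⇔ (*-cancelˡ-∣ p) (*-monoʳ-∣ p)) (q ∣? (p * mixedDot r x)) (q' ∣? mixedDot r x))
             (R'.does-∣-resp-≋ (mixedDot-reduce r x)))

  nSol-p* : ∀ {a b} (B : Vec (Vec (Fin q') b) a) → nSol (vmap (vmap p*_) B) ≡ p ^ b * nSol B
  nSol-p* {b = b} B = begin
      nSol (vmap (vmap p*_) B)
    ≡⟨ nSol-∑ (vmap (vmap p*_) B) ⟩
      ∑ (V b) (λ x → 𝟙 (isSol (vmap (vmap p*_) B) x))
    ≡⟨ ∑-cong (V b) (λ x → cong 𝟙 (isSol-p* B x)) ⟩
      ∑ (V b) (λ x → 𝟙 (isSol B (vmap reduce x)))
    ≡⟨ ∑-reduceᵥ b (λ y → 𝟙 (isSol B y)) ⟩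
      p ^ b * ∑ (V' b) (λ y → 𝟙 (isSol B y))
    ≡⟨ cong (p ^ b *_) (sym (count≡∑𝟙 (isSol B) (V' b))) ⟩
      p ^ b * nSol B ∎
    where open ≡-Reasoning

  module _ (j : ℕ) where

    χ : ∀ {a b} → Vec (Vec (Fin q) b) a → ℕ
    χ A = 𝟙 (nSol A ≡ᵇ p ^ j)

    χ-p*-≤ : ∀ {a b} (B : Vec (Vec (Fin q') b) a) → b ≤ j → χ (vmap (vmap p*_) B) ≡ 𝟙 (nSol B ≡ᵇ p ^ (j ∸ b))
    χ-p*-≤ {b = b} B b≤j = cong 𝟙 (trans (cong (_≡ᵇ p ^ j) (nSol-p* B))
      (does-⇔ (mk⇔ (λ e → *-cancelˡ-≡ (nSol B) (p ^ (j ∸ b)) (p ^ b) {{m^n≢0 p b}} (trans e p^j≡))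
                   (λ e → trans (cong (p ^ b *_) e) (sym p^j≡)))
              (p ^ b * nSol B ≟ p ^ j) (nSol B ≟ p ^ (j ∸ b))))
      where
      p^j≡ : p ^ j ≡ p ^ b * p ^ (j ∸ b)
      p^j≡ = trans (cong (p ^_) (sym (m+[n∸m]≡n b≤j))) (^-distribˡ-+-* p b (j ∸ b))

    χ-p*-> : ∀ {a b} (B : Vec (Vec (Fin q') b) a) → j < b → χ (vmap (vmap p*_) B) ≡ 0
    χ-p*-> {b = b} B j<b = cong 𝟙 (trans (cong (_≡ᵇ p ^ j) (nSol-p* B)) (dec-false (p ^ b * nSol B ≟ p ^ j) too-many))
      where
      too-many : p ^ b * nSol B ≢ p ^ j
      too-many e = <⇒≱ (^-monoʳ-< p p>1 j<b) (begin
          p ^ b        ≡⟨ sym (*-identityʳ (p ^ b)) ⟩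
          p ^ b * 1    ≤⟨ *-monoʳ-≤ (p ^ b) (1≤nSol B) ⟩
          p ^ b * nSol B ≡⟨ e ⟩
          p ^ j        ∎)
        where open ≤-Reasoning

    Et-∑ : ∀ k l b → Et p k l b (suc s) j ≡ ∑ (vecsOf (V b) l) (λ B → 𝟙 ((k <ᵇ b) ∧ (colsDivᵇ k B ∧ not (colsDivᵇ (suc k) B))) * χ B)
    Et-∑ k l b = trans (count≡∑𝟙 _ (vecsOf (V b) l)) (∑-cong (vecsOf (V b) l) (λ B →
      trans (𝟙-∧ (nSol B ≡ᵇ p ^ j) _) (trans (*-comm (χ B) _) (cong (λ z → 𝟙 z * χ B) (firstCol-colsDivᵇ b k B)))))

    Et-≥ : ∀ k l b → ¬ k < b → Et p k l b (suc s) j ≡ 0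
    Et-≥ k l b k≮b = trans (Et-∑ k l b) (trans (∑-cong (vecsOf (V b) l) (λ B → cong (λ z → 𝟙 (z ∧ (colsDivᵇ k B ∧ not (colsDivᵇ (suc k) B))) * χ B) k<ᵇb≡false))
                                               (∑-zero (vecsOf (V b) l)))
      where
      k<ᵇb≡false : (k <ᵇ b) ≡ false
      k<ᵇb≡false = dec-false (k <? b) k≮b

    Ediv : ℕ → ℕ → ℕ → ℕ
    Ediv k l b = ∑ (vecsOf (V b) l) (λ B → 𝟙 (colsDivᵇ k B) * χ B)

    Ediv-all : ∀ l b → Ediv b l b ≡ Eshift p l b s j b
    Ediv-all l b with b ≤ᵇ j in e
    ... | true = begin
        Ediv b l b
      ≡⟨ ∑-allDiv b l χ ⟩
        ∑ (vecsOf (V' b) l) (λ B → χ (vmap (vmap p*_) B))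
      ≡⟨ ∑-cong (vecsOf (V' b) l) (λ B → χ-p*-≤ B (≤ᵇ⇒≤ b j (subst T (sym e) tt))) ⟩
        ∑ (vecsOf (V' b) l) (λ B → 𝟙 (nSol B ≡ᵇ p ^ (j ∸ b)))
      ≡⟨ sym (count≡∑𝟙 (λ A → nSol A ≡ᵇ p ^ (j ∸ b)) (vecsOf (V' b) l)) ⟩
        E p l b s (j ∸ b) ∎
      where open ≡-Reasoning
    ... | false = trans (∑-allDiv b l χ) (trans (∑-cong (vecsOf (V' b) l) (λ B → χ-p*-> B (≰⇒> (λ h → subst T e (≤⇒≤ᵇ h)))))
                                                (∑-zero (vecsOf (V' b) l)))

    Ediv-suc : ∀ k l b → k < b → Ediv k l b ≡ Et p k l b (suc s) j + Ediv (suc k) l b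
    Ediv-suc k l b k<b = trans (∑-cong (vecsOf (V b) l) split-first-column)
      (trans (∑-+ (vecsOf (V b) l) _ _) (cong (_+ Ediv (suc k) l b) (sym (Et-∑ k l b))))
      where
      by-cases : ∀ D D' n → (D' ≡ true → D ≡ true) → 𝟙 D * n ≡ 𝟙 (D ∧ not D') * n + 𝟙 D' * n
      by-cases D true n h rewrite h refl = refl
      by-cases D false n h rewrite ∧-identityʳ D = sym (+-identityʳ _)
      split-first-column : ∀ B → 𝟙 (colsDivᵇ k B) * χ B
        ≡ 𝟙 ((k <ᵇ b) ∧ (colsDivᵇ k B ∧ not (colsDivᵇ (suc k) B))) * χ B + 𝟙 (colsDivᵇ (suc k) B) * χ B
      split-first-column B rewrite dec-true (k <? b) k<b = by-cases (colsDivᵇ k B) (colsDivᵇ (suc k) B) (χ B) (colsDivᵇ-suc⇒ k B)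

    Ediv-telescope : ∀ d k l b → k + d ≡ b → Ediv k l b ≡ ∑ (upTo d) (λ t → Et p (k + t) l b (suc s) j) + Ediv b l b
    Ediv-telescope zero k l b e = cong (λ z → Ediv z l b) (trans (sym (+-identityʳ k)) e)
    Ediv-telescope (suc d) k l b e = begin
        Ediv k l b
      ≡⟨ Ediv-suc k l b (subst (k <_) e (m<m+n k z<s)) ⟩
        Et′ k + Ediv (suc k) l b
      ≡⟨ cong (Et′ k +_) (Ediv-telescope d (suc k) l b (trans (sym (+-suc k d)) e)) ⟩
        Et′ k + (∑ (upTo d) (λ t → Et′ (suc k + t)) + Ediv b l b)
      ≡⟨ sym (+-assoc (Et′ k) _ _) ⟩
        Et′ k + ∑ (upTo d) (λ t → Et′ (suc k + t)) + Ediv b l b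
      ≡⟨ cong (_+ Ediv b l b) (sym (trans (∑-upTo-suc d (λ t → Et′ (k + t)))
           (cong₂ _+_ (cong Et′ (+-identityʳ k)) (∑-cong (upTo d) (λ t → cong Et′ (+-suc k t)))))) ⟩
        ∑ (upTo (suc d)) (λ t → Et′ (k + t)) + Ediv b l b ∎
      where
      open ≡-Reasoning
      Et′ : ℕ → ℕ
      Et′ k = Et p k l b (suc s) j

    module Pivot {b : ℕ} (ι : Fin (suc b)) where

      i : ℕ
      i = toℕ ι

      Rows : (k : ℕ) → List (Vec (Vec (Fin q) (suc b)) k)
      Rows k = vecsOf (V (suc b)) k

      Rows' : (k : ℕ) → List (Vec (Vec (Fin q) b) k)
      Rows' k = vecsOf (V b) k

      module Normalised (ρ : Vec (Fin q) b) (one : Fin q) (ρ-div : prefixDivᵇ i ρ ≡ true) (one≋1 : toℕ one ≋ 1) where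

        pivot : Vec (Fin q) (suc b)
        pivot = insertAt ρ ι one

        shear : Fin q → Vec (Fin q) b → Vec (Fin q) (suc b)
        shear t σ = insertAt (σ ⊕ᵥ (t ⊗ᵥ ρ)) ι t

        ∑-shear : ∀ (H : Vec (Fin q) (suc b) → ℕ) → ∑ (V (suc b)) H ≡ ∑ (allFin q) (λ t → ∑ (V b) (λ σ → H (shear t σ)))
        ∑-shear H = trans (∑-vecsOf-insertAt (allFin q) b ι H)
          (∑-cong (allFin q) (λ t → sym (∑-translateᵥ b (t ⊗ᵥ ρ) (λ σ → H (insertAt σ ι t)))))

        prefixDivᵇ-shear : ∀ t σ → prefixDivᵇ i (shear t σ) ≡ prefixDivᵇ i σ
        prefixDivᵇ-shear t σ = trans (prefixDivᵇ-insertAt (σ ⊕ᵥ (t ⊗ᵥ ρ)) ι t) (prefixDivᵇ-⊕⊗ i σ ρ t ρ-div)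

        prefixDivᵇ-suc-shear : ∀ t σ → prefixDivᵇ (suc i) (shear t σ) ≡ prefixDivᵇ i σ ∧ p∣ᵇ t
        prefixDivᵇ-suc-shear t σ = trans (prefixDivᵇ-suc-insertAt (σ ⊕ᵥ (t ⊗ᵥ ρ)) ι t) (cong (_∧ p∣ᵇ t) (prefixDivᵇ-⊕⊗ i σ ρ t ρ-div))

        colsDivᵇ-shears : ∀ {k} (T : Vec (Fin q) k) (S : Vec (Vec (Fin q) b) k) → colsDivᵇ i (zipWith shear T S) ≡ colsDivᵇ i S
        colsDivᵇ-shears [] [] = refl
        colsDivᵇ-shears (t ∷ T) (σ ∷ S) = cong₂ _∧_ (prefixDivᵇ-shear t σ) (colsDivᵇ-shears T S)

        colsDivᵇ-suc-shears : ∀ {k} (T : Vec (Fin q) k) (S : Vec (Vec (Fin q) b) k) →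
          colsDivᵇ (suc i) (zipWith shear T S) ≡ prefixDivᵇ k T ∧ colsDivᵇ i S
        colsDivᵇ-suc-shears [] [] = refl
        colsDivᵇ-suc-shears (t ∷ T) (σ ∷ S) =
          trans (cong₂ _∧_ (prefixDivᵇ-suc-shear t σ) (colsDivᵇ-suc-shears T S)) (shuffle (prefixDivᵇ i σ) (p∣ᵇ t) _ _)
          where
          shuffle : ∀ a b c d → (a ∧ b) ∧ (c ∧ d) ≡ (b ∧ c) ∧ (a ∧ d)
          shuffle a b c d rewrite ∧-comm a b | ∧-assoc b a (c ∧ d) | ∧-assoc b c (a ∧ d)
            = cong (b ∧_) (trans (sym (∧-assoc a c d)) (trans (cong (_∧ d) (∧-comm a c)) (∧-assoc c a d)))

        rowSolᵇ-pivot : ∀ y c → rowSolᵇ pivot (insertAt y ι c) ≡ does (q ∣? (toℕ c + dot ρ y))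
        rowSolᵇ-pivot y c = does-∣-resp-≋ dot≋
          where
          dot≋ : dot pivot (insertAt y ι c) ≋ (toℕ c + dot ρ y)
          dot≋ = trans (cong (_% q) (dot-insertAt ρ y ι one c))
            (trans (≋-+ (≋-* one≋1 (≋-refl {toℕ c})) (≋-refl {dot ρ y})) (cong (λ z → (z + dot ρ y) % q) (*-identityˡ (toℕ c))))

        rowSolᵇ-shear : ∀ y c t σ → rowSolᵇ pivot (insertAt y ι c) ≡ true → rowSolᵇ (shear t σ) (insertAt y ι c) ≡ rowSolᵇ σ y
        rowSolᵇ-shear y c t σ h = does-∣-resp-≋ (begin
            dot (shear t σ) (insertAt y ι c) % q
          ≡⟨ cong (_% q) (dot-insertAt (σ ⊕ᵥ (t ⊗ᵥ ρ)) y ι t c) ⟩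
            (toℕ t * toℕ c + dot (σ ⊕ᵥ (t ⊗ᵥ ρ)) y) % q
          ≡⟨ ≋-+ (≋-refl {toℕ t * toℕ c}) (dot-⊕⊗ σ ρ y t) ⟩
            (toℕ t * toℕ c + (dot σ y + toℕ t * dot ρ y)) % q
          ≡⟨ cong (_% q) (lemma (toℕ t) (toℕ c) (dot σ y) (dot ρ y)) ⟩
            (dot σ y + toℕ t * (toℕ c + dot ρ y)) % q
          ≡⟨ ≋-+ (≋-refl {dot σ y}) (≋-* (≋-refl {toℕ t}) c+ρy≋0) ⟩
            (dot σ y + toℕ t * 0) % q
          ≡⟨ cong (λ z → (dot σ y + z) % q) (*-zeroʳ (toℕ t)) ⟩
            (dot σ y + 0) % q
          ≡⟨ cong (_% q) (+-identityʳ (dot σ y)) ⟩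
            dot σ y % q ∎)
          where
          open ≡-Reasoning
          c+ρy≋0 : (toℕ c + dot ρ y) ≋ 0
          c+ρy≋0 = ∣⇒≋0 (from-does-true (q ∣? _) (trans (sym (rowSolᵇ-pivot y c)) h))
          lemma : ∀ t c d e → t * c + (d + t * e) ≡ d + t * (c + e)
          lemma = solve-∀

        isSol-shears : ∀ {k} (T : Vec (Fin q) k) (S : Vec (Vec (Fin q) b) k) y c → rowSolᵇ pivot (insertAt y ι c) ≡ true →
          isSol (zipWith shear T S) (insertAt y ι c) ≡ isSol S y
        isSol-shears [] [] y c h = refl
        isSol-shears (t ∷ T) (σ ∷ S) y c h = cong₂ _∧_ (rowSolᵇ-shear y c t σ h) (isSol-shears T S y c h)

        -- Each solution y of the remaining system extends uniquely, through the pivot row, to a solution of the whole one.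
        nSol-shears : ∀ {k n} (T : Vec (Fin q) k) (S : Vec (Vec (Fin q) b) k) (T' : Vec (Fin q) n) (S' : Vec (Vec (Fin q) b) n) →
          nSol (zipWith shear T S ++ᵥ pivot ∷ zipWith shear T' S') ≡ nSol (S ++ᵥ S')
        nSol-shears T S T' S' = begin
            nSol W
          ≡⟨ nSol-∑ W ⟩
            ∑ (V (suc b)) (λ x → 𝟙 (isSol W x))
          ≡⟨ ∑-vecsOf-insertAt (allFin q) b ι _ ⟩
            ∑ (allFin q) (λ c → ∑ (V b) (λ y → 𝟙 (isSol W (insertAt y ι c))))
          ≡⟨ ∑-cong (allFin q) (λ c → ∑-cong (V b) (λ y → trans (cong 𝟙 (isSol-W y c)) (𝟙-∧ (rowSolᵇ pivot (insertAt y ι c)) _))) ⟩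
            ∑ (allFin q) (λ c → ∑ (V b) (λ y → 𝟙 (rowSolᵇ pivot (insertAt y ι c)) * 𝟙 (isSol (S ++ᵥ S') y)))
          ≡⟨ ∑-comm (allFin q) (V b) _ ⟩
            ∑ (V b) (λ y → ∑ (allFin q) (λ c → 𝟙 (rowSolᵇ pivot (insertAt y ι c)) * 𝟙 (isSol (S ++ᵥ S') y)))
          ≡⟨ ∑-cong (V b) (λ y → trans (∑-*ʳ (allFin q) _ (λ c → 𝟙 (rowSolᵇ pivot (insertAt y ι c))))
               (trans (cong (_* 𝟙 (isSol (S ++ᵥ S') y)) (trans (∑-cong (allFin q) (λ c → cong 𝟙 (rowSolᵇ-pivot y c))) (∑-𝟙[c+d≋0]≡1 (dot ρ y))))
                      (*-identityˡ _))) ⟩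
            ∑ (V b) (λ y → 𝟙 (isSol (S ++ᵥ S') y))
          ≡⟨ sym (nSol-∑ (S ++ᵥ S')) ⟩
            nSol (S ++ᵥ S') ∎
          where
          open ≡-Reasoning
          W = zipWith shear T S ++ᵥ pivot ∷ zipWith shear T' S'
          ∧-cond : ∀ a {x y} → (a ≡ true → x ≡ y) → a ∧ x ≡ a ∧ y
          ∧-cond true f = f refl
          ∧-cond false f = refl
          isSol-W : ∀ y c → isSol W (insertAt y ι c) ≡ rowSolᵇ pivot (insertAt y ι c) ∧ isSol (S ++ᵥ S') y
          isSol-W y c = trans (isSol-middle (zipWith shear T S) pivot (zipWith shear T' S') (insertAt y ι c))
            (∧-cond (rowSolᵇ pivot (insertAt y ι c)) (λ h → trans (isSol-++ (zipWith shear T S) (zipWith shear T' S') (insertAt y ι c))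
               (trans (cong₂ _∧_ (isSol-shears T S y c h) (isSol-shears T' S' y c h)) (sym (isSol-++ S S' y)))))

        ∑-around-pivot : ∀ k n →
          ∑ (Rows k) (λ P → ∑ (Rows n) (λ R → 𝟙 (colsDivᵇ (suc i) P) * (𝟙 (colsDivᵇ i R) * χ (P ++ᵥ pivot ∷ R))))
            ≡ q' ^ k * (q ^ n * Ediv i (k + n) b)
        ∑-around-pivot k n = begin
            ∑ (Rows k) (λ P → ∑ (Rows n) (λ R → F P R))
          ≡⟨ ∑-vecsOf-zipWith (V (suc b)) (allFin q) (V b) shear ∑-shear k _ ⟩
            ∑ (V k) (λ T → ∑ (Rows' k) (λ S → ∑ (Rows n) (λ R → F (zipWith shear T S) R)))
          ≡⟨ ∑-cong (V k) (λ T → ∑-cong (Rows' k) (λ S → ∑-vecsOf-zipWith (V (suc b)) (allFin q) (V b) shear ∑-shear n _)) ⟩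
            ∑ (V k) (λ T → ∑ (Rows' k) (λ S → ∑ (V n) (λ T' → ∑ (Rows' n) (λ S' → F (zipWith shear T S) (zipWith shear T' S')))))
          ≡⟨ ∑-cong (V k) (λ T → ∑-cong (Rows' k) (λ S → ∑-cong (V n) (λ T' → ∑-cong (Rows' n) (F-shears T S T')))) ⟩
            ∑ (V k) (λ T → ∑ (Rows' k) (λ S → ∑ (V n) (λ T' → ∑ (Rows' n) (λ S' → 𝟙 (prefixDivᵇ k T) * G S S'))))
          ≡⟨ ∑-cong (V k) (λ T → trans (∑-cong (Rows' k) (λ S → trans (∑-cong (V n) (λ T' → ∑-*ˡ (Rows' n) (𝟙 (prefixDivᵇ k T)) (G S))) (∑-*ˡ (V n) (𝟙 (prefixDivᵇ k T)) (λ _ → ∑ (Rows' n) (G S)))))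
                                      (∑-*ˡ (Rows' k) (𝟙 (prefixDivᵇ k T)) _)) ⟩
            ∑ (V k) (λ T → 𝟙 (prefixDivᵇ k T) * ∑ (Rows' k) (λ S → ∑ (V n) (λ _ → ∑ (Rows' n) (G S))))
          ≡⟨ ∑-cong (V k) (λ T → cong (𝟙 (prefixDivᵇ k T) *_) (∑-comm (Rows' k) (V n) (λ S _ → ∑ (Rows' n) (G S)))) ⟩
            ∑ (V k) (λ T → 𝟙 (prefixDivᵇ k T) * ∑ (V n) (λ _ → Y))
          ≡⟨ ∑-*ʳ (V k) _ (λ T → 𝟙 (prefixDivᵇ k T)) ⟩
            ∑ (V k) (λ T → 𝟙 (prefixDivᵇ k T)) * ∑ (V n) (λ _ → Y)
          ≡⟨ cong₂ _*_ (#allDiv k) (trans (∑-vecsOf-const (allFin q) n Y) (cong (λ m → m ^ n * Y) (List.length-tabulate (λ x → x)))) ⟩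
            q' ^ k * (q ^ n * Y)
          ≡⟨ cong (λ z → q' ^ k * (q ^ n * z)) Y≡Ediv ⟩
            q' ^ k * (q ^ n * Ediv i (k + n) b) ∎
          where
          open ≡-Reasoning
          F : Vec (Vec (Fin q) (suc b)) k → Vec (Vec (Fin q) (suc b)) n → ℕ
          F P R = 𝟙 (colsDivᵇ (suc i) P) * (𝟙 (colsDivᵇ i R) * χ (P ++ᵥ pivot ∷ R))
          G : Vec (Vec (Fin q) b) k → Vec (Vec (Fin q) b) n → ℕ
          G S S' = 𝟙 (colsDivᵇ i S) * (𝟙 (colsDivᵇ i S') * χ (S ++ᵥ S'))
          Y : ℕ
          Y = ∑ (Rows' k) (λ S → ∑ (Rows' n) (G S))
          F-shears : ∀ T S T' S' → F (zipWith shear T S) (zipWith shear T' S') ≡ 𝟙 (prefixDivᵇ k T) * G S S'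
          F-shears T S T' S' = trans
            (cong₂ (λ x y → 𝟙 x * y) (colsDivᵇ-suc-shears T S) (cong₂ (λ x y → 𝟙 x * 𝟙 (y ≡ᵇ p ^ j)) (colsDivᵇ-shears T' S') (nSol-shears T S T' S')))
            (trans (cong (_* (𝟙 (colsDivᵇ i S') * χ (S ++ᵥ S'))) (𝟙-∧ (prefixDivᵇ k T) (colsDivᵇ i S))) (*-assoc (𝟙 (prefixDivᵇ k T)) _ _))
          Y≡Ediv : Y ≡ Ediv i (k + n) b
          Y≡Ediv = trans (∑-cong (Rows' k) (λ S → ∑-cong (Rows' n) (λ S' → trans (sym (*-assoc (𝟙 (colsDivᵇ i S)) _ _))
                     (cong (_* χ (S ++ᵥ S')) (trans (sym (𝟙-∧ (colsDivᵇ i S) (colsDivᵇ i S'))) (cong 𝟙 (sym (colsDivᵇ-++ i S S'))))))))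
                   (∑-vecsOf-++ (V b) k n (λ B → 𝟙 (colsDivᵇ i B) * χ B))

      aroundPivot : ∀ k n → Vec (Fin q) (suc b) → ℕ
      aroundPivot k n r = ∑ (Rows k) (λ P → ∑ (Rows n) (λ R → 𝟙 (colsDivᵇ (suc i) P) * (𝟙 (colsDivᵇ i R) * χ (P ++ᵥ r ∷ R))))

      #pivotPrefixes : ℕ
      #pivotPrefixes = q' ^ i * q ^ (b ∸ i)

      #completions : ℕ → ℕ → ℕ
      #completions k n = q' ^ k * (q ^ n * Ediv i (k + n) b)

      aroundPivot-unit : ∀ k n ρ u → prefixDivᵇ i ρ ≡ true → p∣ᵇ u ≡ false → aroundPivot k n (insertAt ρ ι u) ≡ #completions k n
      aroundPivot-unit k n ρ u ρ-div u-unit with unit-inverse u u-unit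
      ... | v , vu = trans (∑-cong (Rows k) (λ P → ∑-cong (Rows n) (λ R →
                             cong (λ z → 𝟙 (colsDivᵇ (suc i) P) * (𝟙 (colsDivᵇ i R) * 𝟙 (z ≡ᵇ p ^ j))) (normalise P R))))
                           (N.∑-around-pivot k n)
        where
        module N = Normalised (v ⊗ᵥ ρ) (v ⊗ u) (prefixDivᵇ-⊗ i ρ v ρ-div) (trans (residue-≋ (toℕ v * toℕ u)) vu)
        normalise : ∀ {k n} (P : Vec (Vec (Fin q) (suc b)) k) (R : Vec (Vec (Fin q) (suc b)) n) →
          nSol (P ++ᵥ insertAt ρ ι u ∷ R) ≡ nSol (P ++ᵥ N.pivot ∷ R)
        normalise P R = trans (nSol-replace-row P (insertAt ρ ι u) (v ⊗ᵥ insertAt ρ ι u) R (λ x → sym (rowSolᵇ-unit-⊗ (insertAt ρ ι u) x v u vu)))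
                              (cong (λ z → nSol (P ++ᵥ z ∷ R)) (Vec.map-insertAt (v ⊗_) u ρ ι))

      isPivotᵇ : Vec (Fin q) (suc b) → Bool
      isPivotᵇ r = prefixDivᵇ i r ∧ not (prefixDivᵇ (suc i) r)

      ∑-pivots : ∀ k n → ∑ (V (suc b)) (λ r → 𝟙 (isPivotᵇ r) * aroundPivot k n r) ≡ #units * (#pivotPrefixes * #completions k n)
      ∑-pivots k n = begin
          ∑ (V (suc b)) (λ r → 𝟙 (isPivotᵇ r) * aroundPivot k n r)
        ≡⟨ ∑-vecsOf-insertAt (allFin q) b ι _ ⟩
          ∑ (allFin q) (λ u → ∑ (V b) (λ ρ → 𝟙 (isPivotᵇ (insertAt ρ ι u)) * aroundPivot k n (insertAt ρ ι u)))
        ≡⟨ ∑-cong (allFin q) (λ u → ∑-cong (V b) (by-entry u)) ⟩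
          ∑ (allFin q) (λ u → ∑ (V b) (λ ρ → 𝟙 (not (p∣ᵇ u)) * (𝟙 (prefixDivᵇ i ρ) * #completions k n)))
        ≡⟨ ∑-cong (allFin q) (λ u → trans (∑-*ˡ (V b) (𝟙 (not (p∣ᵇ u))) _)
             (cong (𝟙 (not (p∣ᵇ u)) *_) (trans (∑-*ʳ (V b) (#completions k n) _) (cong (_* #completions k n) (#prefixDiv b i (≤-pred (Fin.toℕ<n ι))))))) ⟩
          ∑ (allFin q) (λ u → 𝟙 (not (p∣ᵇ u)) * (#pivotPrefixes * #completions k n))
        ≡⟨ ∑-*ʳ (allFin q) _ (λ u → 𝟙 (not (p∣ᵇ u))) ⟩
          #units * (#pivotPrefixes * #completions k n) ∎
        where
        open ≡-Reasoning
        by-entry : ∀ u ρ → 𝟙 (isPivotᵇ (insertAt ρ ι u)) * aroundPivot k n (insertAt ρ ι u)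
                           ≡ 𝟙 (not (p∣ᵇ u)) * (𝟙 (prefixDivᵇ i ρ) * #completions k n)
        by-entry u ρ rewrite prefixDivᵇ-insertAt ρ ι u | prefixDivᵇ-suc-insertAt ρ ι u with prefixDivᵇ i ρ in ρ-div | p∣ᵇ u in u-div
        ... | false | w = sym (*-zeroʳ (𝟙 (not w)))
        ... | true | true = refl
        ... | true | false = cong (_+ 0) (trans (aroundPivot-unit k n ρ u ρ-div u-div) (sym (+-identityʳ _)))

      -- Matrices P ++ R with first non-multiple of p in column i whose pivot row lies in R.
      Epast : ℕ → ℕ → ℕ
      Epast k n = ∑ (Rows k) (λ P → ∑ (Rows n) (λ R → 𝟙 (colsDivᵇ (suc i) P) * (𝟙 (colsDivᵇ i R ∧ not (colsDivᵇ (suc i) R)) * χ (P ++ᵥ R))))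

      Epast-zero : ∀ k → Epast k 0 ≡ 0
      Epast-zero k = trans (∑-cong (Rows k) (λ P → trans (+-identityʳ _) (*-zeroʳ (𝟙 (colsDivᵇ (suc i) P))))) (∑-zero (Rows k))

      -- The first row r of R is either the pivot, or its column-i entry is divisible by p and r joins P.
      private
        split-first-row : ∀ a a' A A' d (x y : ℕ) → x ≡ y → (a' ≡ true → a ≡ true) →
          𝟙 d * (𝟙 ((a ∧ A) ∧ not (a' ∧ A')) * x) ≡ 𝟙 (a ∧ not a') * (𝟙 d * (𝟙 A * x)) + 𝟙 (a' ∧ d) * (𝟙 (A ∧ not A') * y)
        split-first-row a true A A' d x .x refl h rewrite h refl = refl
        split-first-row false false A A' d x .x refl h = *-zeroʳ (𝟙 d)
        split-first-row true false A A' d x .x refl h rewrite ∧-identityʳ A = trans (sym (+-identityʳ _)) (sym (+-identityʳ _))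

      Epast-suc : ∀ k n → Epast k (suc n) ≡ #units * (#pivotPrefixes * #completions k n) + Epast (suc k) n
      Epast-suc k n = begin
          Epast k (suc n)
        ≡⟨ ∑-cong (Rows k) (λ P → ∑-vecsOf-suc (V (suc b)) n _) ⟩
          ∑ (Rows k) (λ P → ∑ (V (suc b)) (λ r → ∑ (Rows n) (λ R → 𝟙 (colsDivᵇ (suc i) P) *
            (𝟙 ((prefixDivᵇ i r ∧ colsDivᵇ i R) ∧ not (prefixDivᵇ (suc i) r ∧ colsDivᵇ (suc i) R)) * χ (P ++ᵥ r ∷ R)))))
        ≡⟨ ∑-cong (Rows k) (λ P → ∑-cong (V (suc b)) (λ r → ∑-cong (Rows n) (λ R →
             split-first-row (prefixDivᵇ i r) (prefixDivᵇ (suc i) r) (colsDivᵇ i R) (colsDivᵇ (suc i) R) (colsDivᵇ (suc i) P) _ _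
               (cong (λ z → 𝟙 (z ≡ᵇ p ^ j)) (nSol-middle P r R)) (prefixDivᵇ-suc⇒ i r)))) ⟩
          ∑ (Rows k) (λ P → ∑ (V (suc b)) (λ r → ∑ (Rows n) (λ R → pivotFirst P r R + pivotLater P r R)))
        ≡⟨ trans (∑-cong (Rows k) (λ P → trans (∑-cong (V (suc b)) (λ r → ∑-+ (Rows n) (pivotFirst P r) (pivotLater P r))) (∑-+ (V (suc b)) _ _)))
                 (∑-+ (Rows k) _ _) ⟩
          ∑ (Rows k) (λ P → ∑ (V (suc b)) (λ r → ∑ (Rows n) (pivotFirst P r))) + ∑ (Rows k) (λ P → ∑ (V (suc b)) (λ r → ∑ (Rows n) (pivotLater P r)))
        ≡⟨ cong₂ _+_ (trans (∑-comm (Rows k) (V (suc b)) _) first) (trans (∑-comm (Rows k) (V (suc b)) _) (sym (∑-vecsOf-suc (V (suc b)) k _))) ⟩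
          #units * (#pivotPrefixes * #completions k n) + Epast (suc k) n ∎
        where
        open ≡-Reasoning
        pivotFirst : Vec (Vec (Fin q) (suc b)) k → Vec (Fin q) (suc b) → Vec (Vec (Fin q) (suc b)) n → ℕ
        pivotFirst P r R = 𝟙 (isPivotᵇ r) * (𝟙 (colsDivᵇ (suc i) P) * (𝟙 (colsDivᵇ i R) * χ (P ++ᵥ r ∷ R)))
        pivotLater : Vec (Vec (Fin q) (suc b)) k → Vec (Fin q) (suc b) → Vec (Vec (Fin q) (suc b)) n → ℕ
        pivotLater P r R = 𝟙 (prefixDivᵇ (suc i) r ∧ colsDivᵇ (suc i) P) * (𝟙 (colsDivᵇ i R ∧ not (colsDivᵇ (suc i) R)) * χ (r ∷ (P ++ᵥ R)))
        first : ∑ (V (suc b)) (λ r → ∑ (Rows k) (λ P → ∑ (Rows n) (pivotFirst P r))) ≡ #units * (#pivotPrefixes * #completions k n)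
        first = trans (∑-cong (V (suc b)) (λ r → trans (∑-cong (Rows k) (λ P → ∑-*ˡ (Rows n) (𝟙 (isPivotᵇ r)) _)) (∑-*ˡ (Rows k) (𝟙 (isPivotᵇ r)) _)))
                      (∑-pivots k n)

      Epast-φ : ∀ n k → Epast k (suc n) ≡ q' ^ k * (φ (suc n) q * (#pivotPrefixes * Ediv i (k + n) b))
      Epast-φ zero k = begin
          Epast k 1
        ≡⟨ Epast-suc k 0 ⟩
          #units * (X * #completions k 0) + Epast (suc k) 0
        ≡⟨ cong (#units * (X * #completions k 0) +_) (Epast-zero (suc k)) ⟩
          #units * (X * (q' ^ k * (1 * Ediv i (k + 0) b))) + 0
        ≡⟨ lemma #units X (q' ^ k) (Ediv i (k + 0) b) q' ⟩
          q' ^ k * ((#units * 1 + q' * 0) * (X * Ediv i (k + 0) b))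
        ≡⟨ cong (λ z → q' ^ k * (z * (X * Ediv i (k + 0) b))) (sym (φ-suc 0)) ⟩
          q' ^ k * (φ 1 q * (X * Ediv i (k + 0) b)) ∎
        where
        open ≡-Reasoning
        X = #pivotPrefixes
        lemma : ∀ U X a N q' → U * (X * (a * (1 * N))) + 0 ≡ a * ((U * 1 + q' * 0) * (X * N))
        lemma = solve-∀
      Epast-φ (suc n) k = begin
          Epast k (suc (suc n))
        ≡⟨ Epast-suc k (suc n) ⟩
          #units * (X * #completions k (suc n)) + Epast (suc k) (suc n)
        ≡⟨ cong (#units * (X * #completions k (suc n)) +_) (Epast-φ n (suc k)) ⟩
          #units * (X * #completions k (suc n)) + q' ^ suc k * (φ (suc n) q * (X * Ediv i (suc k + n) b))
        ≡⟨ cong (λ z → #units * (X * #completions k (suc n)) + q' ^ suc k * (φ (suc n) q * (X * Ediv i z b))) (sym (+-suc k n)) ⟩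
          #units * (X * (q' ^ k * (q ^ suc n * N))) + q' * q' ^ k * (φ (suc n) q * (X * N))
        ≡⟨ lemma #units X (q' ^ k) (q ^ suc n) q' (φ (suc n) q) N ⟩
          q' ^ k * ((#units * q ^ suc n + q' * φ (suc n) q) * (X * N))
        ≡⟨ cong (λ z → q' ^ k * (z * (X * N))) (sym (φ-suc (suc n))) ⟩
          q' ^ k * (φ (suc (suc n)) q * (X * N)) ∎
        where
        open ≡-Reasoning
        X = #pivotPrefixes
        N = Ediv i (k + suc n) b
        lemma : ∀ U X a w q' f N → U * (X * (a * (w * N))) + q' * a * (f * (X * N)) ≡ a * ((U * w + q' * f) * (X * N))
        lemma = solve-∀

    Et-pivot : ∀ b l i → i < suc b → Et p i (suc l) (suc b) (suc s) j ≡ φ (suc l) q * (q' ^ i * q ^ (b ∸ i) * Ediv i l b)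
    Et-pivot b l i i<1+b = subst (λ z → Et p z (suc l) (suc b) (suc s) j ≡ φ (suc l) q * (q' ^ z * q ^ (b ∸ z) * Ediv z l b))
                                 (Fin.toℕ-fromℕ< i<1+b) (at (fromℕ< i<1+b))
      where
      at : (ι : Fin (suc b)) → Et p (toℕ ι) (suc l) (suc b) (suc s) j ≡ φ (suc l) q * (q' ^ toℕ ι * q ^ (b ∸ toℕ ι) * Ediv (toℕ ι) l b)
      at ι = begin
          Et p i′ (suc l) (suc b) (suc s) j
        ≡⟨ Et-∑ i′ (suc l) (suc b) ⟩
          ∑ (Rows (suc l)) (λ A → 𝟙 ((i′ <ᵇ suc b) ∧ (colsDivᵇ i′ A ∧ not (colsDivᵇ (suc i′) A))) * χ A)
        ≡⟨ ∑-cong (Rows (suc l)) (λ A → cong (λ z → 𝟙 (z ∧ (colsDivᵇ i′ A ∧ not (colsDivᵇ (suc i′) A))) * χ A) (dec-true (i′ <? suc b) (Fin.toℕ<n ι))) ⟩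
          ∑ (Rows (suc l)) (λ A → 𝟙 (colsDivᵇ i′ A ∧ not (colsDivᵇ (suc i′) A)) * χ A)
        ≡⟨ sym (trans (+-identityʳ _) (∑-cong (Rows (suc l)) (λ A → *-identityˡ _))) ⟩
          Epast 0 (suc l)
        ≡⟨ Epast-φ l 0 ⟩
          1 * (φ (suc l) q * (q' ^ i′ * q ^ (b ∸ i′) * Ediv i′ l b))
        ≡⟨ *-identityˡ _ ⟩
          φ (suc l) q * (q' ^ i′ * q ^ (b ∸ i′) * Ediv i′ l b) ∎
        where
        open ≡-Reasoning
        open Pivot ι renaming (i to i′)

    Et-vanish : ∀ l b k → j < k → Et p k l b (suc s) j ≡ 0
    Et-vanish l b k j<k with k <? b
    ... | no k≮b = Et-≥ k l b k≮b
    Et-vanish zero b k j<k | yes k<b = trans (Et-∑ k 0 b) (cong (λ z → 𝟙 z * χ {b = b} [] + 0) (∧-zeroʳ (k <ᵇ b)))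
    Et-vanish (suc l) (suc b) k j<k | yes k<1+b = begin
        Et p k (suc l) (suc b) (suc s) j
      ≡⟨ Et-pivot b l k k<1+b ⟩
        φ (suc l) q * (q' ^ k * q ^ (b ∸ k) * Ediv k l b)
      ≡⟨ cong (λ z → φ (suc l) q * (q' ^ k * q ^ (b ∸ k) * z)) Ediv≡0 ⟩
        φ (suc l) q * (q' ^ k * q ^ (b ∸ k) * 0)
      ≡⟨ cong (φ (suc l) q *_) (*-zeroʳ (q' ^ k * q ^ (b ∸ k))) ⟩
        φ (suc l) q * 0
      ≡⟨ *-zeroʳ (φ (suc l) q) ⟩
        0 ∎
      where
      open ≡-Reasoning
      k≤b : k ≤ b
      k≤b = ≤-pred k<1+b
      Eshift≡0 : Eshift p l b s j b ≡ 0
      Eshift≡0 rewrite dec-false (b ≤? j) (<⇒≱ (<-≤-trans j<k k≤b)) = refl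
      Ediv≡0 : Ediv k l b ≡ 0
      Ediv≡0 = begin
          Ediv k l b
        ≡⟨ Ediv-telescope (b ∸ k) k l b (m+[n∸m]≡n k≤b) ⟩
          ∑ (upTo (b ∸ k)) (λ t → Et p (k + t) l b (suc s) j) + Ediv b l b
        ≡⟨ cong₂ _+_ (trans (∑-cong (upTo (b ∸ k)) (λ t → Et-vanish l b (k + t) (<-≤-trans j<k (m≤m+n k t)))) (∑-zero (upTo (b ∸ k))))
                     (trans (Ediv-all l b) Eshift≡0) ⟩
          0 ∎

    ∑-Et-truncate : ∀ b l i → ∑ (upTo (suc b ∸ i)) (λ t → Et p (i + t) l (suc b) (suc s) j)
                              ≡ sumRange i (j ⊓ b) (λ k → Et p k l (suc b) (suc s) j)
    ∑-Et-truncate b l i = begin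
        ∑ (upTo (suc b ∸ i)) f
      ≡⟨ cong (λ z → ∑ (upTo z) f) (sym (m+[n∸m]≡n len≤)) ⟩
        ∑ (upTo (len + rest)) f
      ≡⟨ ∑-upTo-+ len rest f ⟩
        ∑ (upTo len) f + ∑ (upTo rest) (λ t → f (len + t))
      ≡⟨ cong (∑ (upTo len) f +_) (trans (∑-cong (upTo rest) (λ t → beyond (i + (len + t)) (≤-trans (m≤n+m∸n (suc (j ⊓ b)) i) (+-monoʳ-≤ i (m≤m+n len t)))))
                                         (∑-zero (upTo rest))) ⟩
        ∑ (upTo len) f + 0
      ≡⟨ +-identityʳ _ ⟩
        ∑ (upTo len) f ∎
      where
      open ≡-Reasoning
      f : ℕ → ℕ
      f t = Et p (i + t) l (suc b) (suc s) j
      len = suc (j ⊓ b) ∸ i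
      rest = (suc b ∸ i) ∸ len
      len≤ : len ≤ suc b ∸ i
      len≤ = ∸-monoˡ-≤ i (s≤s (m⊓n≤n j b))
      beyond : ∀ k → suc (j ⊓ b) ≤ k → Et p k l (suc b) (suc s) j ≡ 0
      beyond k j⊓b<k with k <? suc b
      ... | no k≮1+b = Et-≥ k l (suc b) k≮1+b
      ... | yes k<1+b = Et-vanish l (suc b) k (≰⇒> (λ k≤j → n≮n (j ⊓ b) (<-≤-trans j⊓b<k (⊓-glb k≤j (≤-pred k<1+b)))))

    Et-recurrence : ∀ b l i → i ≤ suc b → Et p i (suc l) (suc (suc b)) (suc s) j ≡
      φ (suc l) q * q' ^ i * q ^ (suc (suc b) ∸ (i + 1)) * (Eshift p l (suc b) s j (suc b) + sumRange i (j ⊓ b) (λ k → Et p k l (suc b) (suc s) j))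
    Et-recurrence b l i i≤1+b = begin
        Et p i (suc l) (suc (suc b)) (suc s) j
      ≡⟨ Et-pivot (suc b) l i (s≤s i≤1+b) ⟩
        φ (suc l) q * (q' ^ i * q ^ (suc b ∸ i) * Ediv i l (suc b))
      ≡⟨ cong (λ z → φ (suc l) q * (q' ^ i * q ^ (suc b ∸ i) * z)) (Ediv-telescope (suc b ∸ i) i l (suc b) (m+[n∸m]≡n i≤1+b)) ⟩
        φ (suc l) q * (q' ^ i * q ^ (suc b ∸ i) * (∑ (upTo (suc b ∸ i)) (λ t → Et p (i + t) l (suc b) (suc s) j) + Ediv (suc b) l (suc b)))
      ≡⟨ cong (λ z → φ (suc l) q * (q' ^ i * q ^ (suc b ∸ i) * z)) (trans (cong₂ _+_ (∑-Et-truncate b l i) (Ediv-all l (suc b))) (+-comm (sumRange i (j ⊓ b) (λ k → Et p k l (suc b) (suc s) j)) _)) ⟩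
        φ (suc l) q * (q' ^ i * q ^ (suc b ∸ i) * (Eshift p l (suc b) s j (suc b) + sumRange i (j ⊓ b) (λ k → Et p k l (suc b) (suc s) j)))
      ≡⟨ lemma (φ (suc l) q) (q' ^ i) (q ^ (suc b ∸ i)) _ ⟩
        φ (suc l) q * q' ^ i * q ^ (suc b ∸ i) * (Eshift p l (suc b) s j (suc b) + sumRange i (j ⊓ b) (λ k → Et p k l (suc b) (suc s) j))
      ≡⟨ cong (λ e → φ (suc l) q * q' ^ i * q ^ (suc (suc b) ∸ e) * (Eshift p l (suc b) s j (suc b) + sumRange i (j ⊓ b) (λ k → Et p k l (suc b) (suc s) j))) (+-comm 1 i) ⟩
        φ (suc l) q * q' ^ i * q ^ (suc (suc b) ∸ (i + 1)) * (Eshift p l (suc b) s j (suc b) + sumRange i (j ⊓ b) (λ k → Et p k l (suc b) (suc s) j)) ∎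
      where
      open ≡-Reasoning
      lemma : ∀ f a c z → f * (a * c * z) ≡ f * a * c * z
      lemma = solve-∀

proposition3p9 : (p : ℕ) → Prime p → (s n m i j : ℕ) →
    1 ≤ s → 2 ≤ n → 2 ≤ m → i ≤ m ∸ 1 →
    (Et p i n m s j ≡
       φ n (p ^ s) * (p ^ (s ∸ 1)) ^ i * (p ^ s) ^ (m ∸ (i + 1)) *
       (Eshift p (n ∸ 1) (m ∸ 1) (s ∸ 1) j (m ∸ 1) +
        sumRange i (j ⊓ (m ∸ 2)) (λ k → Et p k (n ∸ 1) (m ∸ 1) s j)))
    × (j < i → Et p i n m s j ≡ 0)
proposition3p9 p p-prime (suc s) (suc (suc l)) (suc (suc b)) i j (s≤s z≤n) (s≤s (s≤s z≤n)) (s≤s (s≤s z≤n)) i≤1+b =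
  Et-recurrence j b (suc l) i i≤1+b , Et-vanish j (suc (suc l)) (suc (suc b)) i
  where open PrimePower p p-prime s
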